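{- Let $m\ge1$ and $\bar u\in J_m$. Suppose $\bar v\in\mathbb{N}^s$ with $\bar v\le\bar\rho$ and $\bar v<\bar u$, where $\bar\rho=[p-1,\dots,p-1]^t$. Then $\bar u-\bar v\in I_m\cup J_{m-1}$, where $J_0:=\emptyset$.
   Context: Let $p$ be a prime, $s\ge1$. For $N=\sum_jn_jp^j$ (base $p$), $\Gamma(N)=[u_0,\dots,u_{s-1}]^t$ with $u_i=\sum_{j\equiv i\pmod s}n_j$. $V_m(k)$ is the set of $m$-tuples of positive integers summing to $k$ with no carryover of $p$-adic digits in the sum and with $(p^s-1)\mid X_j$ for $1\le j\le m-1$. $\mathfrak{J}:=\{\Gamma(k):k\text{ a positive multiple of }p^s-1\}$, $I_m:=\{\Gamma(k):k\in\mathbb{N},V_m(k)\neq\emptyset\}$, $J_m:=\mathfrak{J}\cap(I_m\setminus I_{m+1})$. $\bar x\le\bar y$ is componentwise; $\bar x<\bar y$ means $\bar x\le\bar y$ and $\bar x\ne\bar y$. -}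

module Defs where

open import Data.Nat using (ℕ; zero; suc; _+_; _*_; _∸_; _^_; _≤_; _<_; NonZero; nonTrivial⇒nonZero)
open import Data.Nat.DivMod using (_/_; _%_)
open import Data.Nat.Divisibility using (_∣_)
open import Data.Nat.Primality using (Prime; prime)
open import Data.Fin using (Fin; toℕ)
open import Data.List using (List; map; upTo)
open import Data.Nat.ListAction using (sum)
open import Data.Vec using (Vec; tabulate; lookup; replicate; zipWith)
open import Data.Vec.Relation.Unary.All using (All)
open import Data.Vec.Relation.Binary.Pointwise.Inductive using (Pointwise)
open import Data.Product using (Σ; ∃; _×_)
open import Data.Empty using (⊥)
open import Relation.Nullary using (¬_)
open import Relation.Binary.PropositionalEquality using (_≡_; _≢_)

prime⇒nonZero : ∀ {p} → Prime p → NonZero p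
prime⇒nonZero {p} (prime _) = nonTrivial⇒nonZero p

shift : ∀ {p} → Prime p → ℕ → ℕ → ℕ
shift pr zero    N = N
shift {p} pr (suc j) N = _/_ (shift pr j N) p {{prime⇒nonZero pr}}

digit : ∀ {p} → Prime p → ℕ → ℕ → ℕ
digit {p} pr j N = _%_ (shift pr j N) p {{prime⇒nonZero pr}}

-- Γ(N) = [u_0,…,u_{s-1}], u_i = Σ_{j ≡ i (mod s)} n_j.
-- The indices j ≡ i (mod s) are j = i + q*s (q ≥ 0); digits with j > N
-- vanish (p^j > N), so q ranging over 0..N covers all nonzero digits.
Γ : ∀ {p} → Prime p → (s : ℕ) → ℕ → Vec ℕ s
Γ pr s N = tabulate (λ i → sum (map (λ q → digit pr (toℕ i + q * s) N) (upTo (suc N))))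

M : ℕ → ℕ → ℕ
M p s = p ^ s ∸ 1

-- X = (X_1,…,X_m) ∈ V_m(k): positive entries, summing to k, no carry in any
-- base-p digit position, and (p^s - 1) ∣ X_j for 1 ≤ j ≤ m-1.
record InV {p} (pr : Prime p) (s m k : ℕ) (X : Vec ℕ m) : Set where
  field
    positive : All (λ x → 0 < x) X
    sums     : Data.Vec.sum X ≡ k
    noCarry  : ∀ (j : ℕ) → Data.Vec.sum (Data.Vec.map (digit pr j) X) < p
    divides  : ∀ (i : Fin m) → suc (toℕ i) < m → M p s ∣ lookup X i

V : ∀ {p} → Prime p → (s m k : ℕ) → Set
V pr s m k = Σ (Vec ℕ m) (InV pr s m k)

Jfrak : ∀ {p} → Prime p → (s : ℕ) → Vec ℕ s → Set
Jfrak {p} pr s u = ∃ λ k → 0 < k × M p s ∣ k × Γ pr s k ≡ u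

I : ∀ {p} → Prime p → (s m : ℕ) → Vec ℕ s → Set
I pr s m u = ∃ λ k → Γ pr s k ≡ u × V pr s m k

J : ∀ {p} → Prime p → (s m : ℕ) → Vec ℕ s → Set
J pr s zero    u = ⊥
J pr s (suc n) u = Jfrak pr s u × I pr s (suc n) u × ¬ I pr s (suc (suc n)) u

_≤ᵥ_ : ∀ {s} → Vec ℕ s → Vec ℕ s → Set
x ≤ᵥ y = Pointwise _≤_ x y

_<ᵥ_ : ∀ {s} → Vec ℕ s → Vec ℕ s → Set
x <ᵥ y = x ≤ᵥ y × x ≢ y

ρ : (p s : ℕ) → Vec ℕ s
ρ p s = replicate s (p ∸ 1)

_-ᵥ_ : ∀ {s} → Vec ℕ s → Vec ℕ s → Vec ℕ s
x -ᵥ y = zipWith _∸_ x y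

-- Work with vectors instead of numbers. A vector is Γ(k) for some k with V_(m+1)(k) ≠ ∅ exactly
-- when it is a sum of m + 1 nonzero vectors, all but the last of base-p value divisible by
-- M = p^s - 1: the parts of k have no carries, so Γ adds up over them, and conversely each part
-- is realised by a number with one unit digit per block of s digits, the parts being shifted to
-- disjoint digit ranges. Since value (Γ k) ≡ k (mod M), for u ∈ J_m every part lies in 𝔍.
--
-- An exchange argument moves v ≤ ρ into a single part. For a, b ∈ 𝔍 with v = α + β ≤ a + b,
-- reduce b - β by cyclic carries (p units at position i are worth one unit at i + 1, and p^s ≡ 1)
-- to a digit vector w. Then value w + value β is a positive multiple of M and at most 2M, which
-- forces ρ - β ≤ w, and every sub-vector of w lifts mod M to a sub-vector of b - β; lifting α gives
-- z ≤ b - β with (a - α) + z ∈ 𝔍 below a + b - v, to be split off as a new second part.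
--
-- Now u = d + rest with v ≤ d. If v ≠ ρ then d - v ≠ 0, so u - v ∈ I_m. If v = ρ then d - v
-- has value ≡ 0 and merges into another part, so u - v ∈ 𝔍 ∩ I_(m-1), while u - v ∈ I_m would
-- give u = (u - v) + ρ ∈ I_(m+1).

{-# OPTIONS --safe #-}
module Submission where

open import Defs
open import Data.Nat
open import Data.Nat.Properties
open import Data.Nat.DivMod
  using ( m≡m%n+[m/n]*n; m%n<n; m<n⇒m%n≡m; m<n⇒m/n≡0; m/n≡0⇒m<n; m/n<m; m<n*o⇒m/o<n; m*n/n≡m
        ; %-congˡ; /-congˡ; %-distribˡ-+; [m+kn]%n≡m%n; +-distrib-/; +-distrib-/-∣ʳ)
open import Data.Nat.Divisibility using (_∣_; divides; ∣-refl; ∣m+n∣m⇒∣n; ∣m∣n⇒∣m+n; ∣n⇒∣m*n; ∣⇒≤)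
open import Data.Nat.Induction using (<-rec; <-wellFounded)
open import Data.Nat.ListAction using (sum)
open import Data.Nat.Primality using (Prime; prime⇒nonTrivial)
open import Data.Nat.Tactic.RingSolver using (solve-∀)
open import Algebra.Properties.CommutativeSemigroup +-commutativeSemigroup using (interchange; xy∙z≈xz∙y)
open import Data.Bool using (if_then_else_)
open import Data.Empty using (⊥; ⊥-elim)
open import Data.Fin using (Fin; toℕ; fromℕ<) renaming (zero to fzero; suc to fsuc)
open import Data.Fin.Properties using (toℕ<n; toℕ-injective; toℕ-fromℕ<; all?) renaming (_≟_ to _≟ᶠ_)
open import Data.List using (List; []; _∷_; _++_; applyUpTo; upTo; length; map)
  renaming (replicate to replicateᴸ)
open import Data.List.Relation.Unary.All using (All; []; _∷_)
open import Data.Product using (∃; ∃₂; _×_; _,_; proj₁; proj₂)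
open import Data.Sum using (_⊎_; inj₁; inj₂) renaming (map to map-⊎)
open import Data.Vec using (Vec; []; _∷_)
import Data.Vec as Vec
open import Data.Vec.Properties
  using (lookup∘tabulate; tabulate∘lookup; tabulate-cong; lookup-map; lookup-zipWith; lookup-replicate)
import Data.Vec.Relation.Unary.All as VecAll
open import Data.Vec.Relation.Unary.All.Properties using (map⁺)
open import Data.Vec.Relation.Binary.Pointwise.Inductive using () renaming (lookup to lookup-Pointwise)
open import Data.Vec.Functional using (Vector; zipWith; head; tail)
open import Data.Vec.Functional.Relation.Binary.Pointwise using (Pointwise)
open import Data.Vec.Functional.Relation.Unary.Any using (Any; any)
open import Function using (_∘_; id)
import Induction.WellFounded as WF
open import Level using (0ℓ)
open import Relation.Binary.Bundles using (Setoid)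
import Relation.Binary.Construct.On as On
open import Relation.Binary.Definitions using (tri<; tri≈; tri>)
open import Relation.Binary.PropositionalEquality
  using (_≡_; _≢_; _≗_; refl; sym; trans; cong; cong₂; subst; subst₂; module ≡-Reasoning)
import Relation.Binary.Reasoning.Setoid
open import Relation.Nullary using (¬_; yes; no; does)
open import Relation.Nullary.Decidable using (dec-true; dec-false)

x≤y∸c+b⇒x∸b+c≤y : ∀ {x y b c} → x ≤ y ∸ c + b → c ≤ y → x ∸ b + c ≤ y
x≤y∸c+b⇒x∸b+c≤y {x} {y} {b} {c} x≤y∸c+b c≤y = begin
  x ∸ b + c  ≤⟨ +-monoˡ-≤ c (subst (x ∸ b ≤_) (m+n∸n≡m (y ∸ c) b) (∸-monoˡ-≤ b x≤y∸c+b)) ⟩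
  y ∸ c + c  ≡⟨ m∸n+n≡m c≤y ⟩
  y          ∎
  where open ≤-Reasoning

positive-multiple≤n+n : ∀ {n x} → n ∣ x → 0 < x → x ≤ n + n → x ≡ n ⊎ x ≡ n + n
positive-multiple≤n+n     (divides 0                   refl) ()
positive-multiple≤n+n     (divides 1                   refl) _ _ = inj₁ (+-identityʳ _)
positive-multiple≤n+n {n} (divides 2                   refl) _ _ = inj₂ (cong (n +_) (+-identityʳ n))
positive-multiple≤n+n {n} (divides (suc (suc (suc q))) refl) 0<x x≤2n = ⊥-elim (<⇒≱ 2n<x x≤2n)
  where
    0<n : 0 < n
    0<n = n≢0⇒n>0 (λ { refl → <-irrefl (sym (*-zeroʳ (3 + q))) 0<x })
    2n<x : n + n < (3 + q) * n
    2n<x = +-monoʳ-< n (subst (_< n + (n + q * n)) (+-identityʳ n) (+-monoʳ-< n (<-≤-trans 0<n (m≤m+n n (q * n)))))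

[m∸n]+[o∸q]≡[m+o]∸[n+q] : ∀ {m n o q} → n ≤ m → q ≤ o → (m ∸ n) + (o ∸ q) ≡ (m + o) ∸ (n + q)
[m∸n]+[o∸q]≡[m+o]∸[n+q] {m} {n} {o} {q} n≤m q≤o = begin
  (m ∸ n) + (o ∸ q)  ≡⟨ sym (+-∸-assoc (m ∸ n) q≤o) ⟩
  (m ∸ n) + o ∸ q    ≡⟨ cong (_∸ q) (sym (+-∸-comm o n≤m)) ⟩
  (m + o) ∸ n ∸ q    ≡⟨ ∸-+-assoc (m + o) n q ⟩
  (m + o) ∸ (n + q)  ∎
  where open ≡-Reasoning

sum-map-* : ∀ {n} c (X : Vec ℕ n) → Vec.sum (Vec.map (c *_) X) ≡ c * Vec.sum X
sum-map-* c []      = sym (*-zeroʳ c)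
sum-map-* c (x ∷ X) = trans (cong (c * x +_) (sum-map-* c X)) (sym (*-distribˡ-+ c x (Vec.sum X)))

sum-applyUpTo-cong : ∀ L {f g : ℕ → ℕ} → f ≗ g → sum (applyUpTo f L) ≡ sum (applyUpTo g L)
sum-applyUpTo-cong zero    f≗g = refl
sum-applyUpTo-cong (suc L) f≗g = cong₂ _+_ (f≗g 0) (sum-applyUpTo-cong L (f≗g ∘ suc))

sum-applyUpTo-+ : ∀ L (f g : ℕ → ℕ) →
  sum (applyUpTo (λ q → f q + g q) L) ≡ sum (applyUpTo f L) + sum (applyUpTo g L)
sum-applyUpTo-+ zero    f g = refl
sum-applyUpTo-+ (suc L) f g =
  trans (cong (f 0 + g 0 +_) (sum-applyUpTo-+ L (f ∘ suc) (g ∘ suc))) (interchange (f 0) (g 0) _ _)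

sum-applyUpTo-vanishing : ∀ K L (f : ℕ → ℕ) → K ≤ L → (∀ q → K ≤ q → f q ≡ 0) →
  sum (applyUpTo f L) ≡ sum (applyUpTo f K)
sum-applyUpTo-vanishing zero    zero    f _ _ = refl
sum-applyUpTo-vanishing zero    (suc L) f _ f≡0 =
  cong₂ _+_ (f≡0 0 z≤n) (sum-applyUpTo-vanishing 0 L (f ∘ suc) z≤n (λ q _ → f≡0 (suc q) z≤n))
sum-applyUpTo-vanishing (suc K) (suc L) f (s≤s K≤L) f≡0 =
  cong (f 0 +_) (sum-applyUpTo-vanishing K L (f ∘ suc) K≤L (λ q K≤q → f≡0 (suc q) (s≤s K≤q)))

map-applyUpTo : ∀ (f g : ℕ → ℕ) L → map f (applyUpTo g L) ≡ applyUpTo (f ∘ g) L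
map-applyUpTo f g zero    = refl
map-applyUpTo f g (suc L) = cong (f (g 0) ∷_) (map-applyUpTo f (g ∘ suc) L)

module Modulo (n : ℕ) where

  infix 4 _≈_
  _≈_ : ℕ → ℕ → Set
  a ≈ b = ∃₂ λ k l → a + k * n ≡ b + l * n

  ≡⇒≈ : ∀ {a b} → a ≡ b → a ≈ b
  ≡⇒≈ refl = 0 , 0 , refl

  ≈-refl : ∀ {a} → a ≈ a
  ≈-refl = ≡⇒≈ refl

  ≈-sym : ∀ {a b} → a ≈ b → b ≈ a
  ≈-sym (k , l , eq) = l , k , sym eq

  ≈-trans : ∀ {a b c} → a ≈ b → b ≈ c → a ≈ c
  ≈-trans {a} {b} {c} (k , l , a≡b) (k′ , l′ , b≡c) = k + k′ , l′ + l , (begin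
      a + (k + k′) * n    ≡⟨ distrib a k k′ n ⟩
      a + k * n + k′ * n  ≡⟨ cong (_+ k′ * n) a≡b ⟩
      b + l * n + k′ * n  ≡⟨ xy∙z≈xz∙y b (l * n) (k′ * n) ⟩
      b + k′ * n + l * n  ≡⟨ cong (_+ l * n) b≡c ⟩
      c + l′ * n + l * n  ≡⟨ sym (distrib c l′ l n) ⟩
      c + (l′ + l) * n    ∎)
    where
      open ≡-Reasoning
      distrib : ∀ x y z w → x + (y + z) * w ≡ x + y * w + z * w
      distrib = solve-∀

  +-cong : ∀ {a b c d} → a ≈ b → c ≈ d → a + c ≈ b + d
  +-cong {a} {b} {c} {d} (k , l , a≡b) (k′ , l′ , c≡d) =
    k + k′ , l + l′ , trans (shuffle a c k k′ n) (trans (cong₂ _+_ a≡b c≡d) (sym (shuffle b d l l′ n)))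
    where
      shuffle : ∀ x y z w m → x + y + (z + w) * m ≡ (x + z * m) + (y + w * m)
      shuffle = solve-∀

  +-cancelʳ : ∀ {a b c d} → a + c ≡ b + d → c ≈ d → a ≈ b
  +-cancelʳ {a} {b} {c} {d} eq (k , l , c≡d) = l , k , +-cancelʳ-≡ d (a + l * n) (b + k * n) (begin
      a + l * n + d    ≡⟨ +-assoc a (l * n) d ⟩
      a + (l * n + d)  ≡⟨ cong (a +_) (+-comm (l * n) d) ⟩
      a + (d + l * n)  ≡⟨ cong (a +_) (sym c≡d) ⟩
      a + (c + k * n)  ≡⟨ sym (+-assoc a c (k * n)) ⟩
      a + c + k * n    ≡⟨ cong (_+ k * n) eq ⟩
      b + d + k * n    ≡⟨ xy∙z≈xz∙y b d (k * n) ⟩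
      b + k * n + d    ∎)
    where open ≡-Reasoning

  ∣⇒≈0 : ∀ {a} → n ∣ a → a ≈ 0
  ∣⇒≈0 {a} (divides q a≡qn) = 0 , q , trans (+-identityʳ a) a≡qn

  ≈0⇒∣ : ∀ {a} → a ≈ 0 → n ∣ a
  ≈0⇒∣ {a} (k , l , eq) = ∣m+n∣m⇒∣n (divides l (trans (+-comm (k * n) a) eq)) (divides k refl)

  ≈-∣ : ∀ {a b} → a ≈ b → n ∣ a → n ∣ b
  ≈-∣ a≈b n∣a = ≈0⇒∣ (≈-trans (≈-sym a≈b) (∣⇒≈0 n∣a))

  ≈-setoid : Setoid 0ℓ 0ℓ
  ≈-setoid = record
    { Carrier       = ℕ
    ; _≈_           = _≈_
    ; isEquivalence = record { refl = ≈-refl ; sym = ≈-sym ; trans = ≈-trans }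
    }

  module ≈-Reasoning = Relation.Binary.Reasoning.Setoid ≈-setoid

  suc-*-≈ : ∀ a → suc n * a ≈ a
  suc-*-≈ a = 0 , a , trans (+-identityʳ (suc n * a)) (cong (a +_) (*-comm n a))

module Digits {p : ℕ} (pr : Prime p) where

  instance
    p-nonZero : NonZero p
    p-nonZero = prime⇒nonZero pr

  1<p : 1 < p
  1<p = nonTrivial⇒n>1 p {{prime⇒nonTrivial pr}}

  n<p^n : ∀ n → n < p ^ n
  n<p^n zero    = s≤s z≤n
  n<p^n (suc n) = ≤-<-trans (n<p^n n) (^-monoʳ-< p 1<p (n<1+n n))

  digit<p : ∀ j N → digit pr j N < p
  digit<p j N = m%n<n (shift pr j N) p

  [m+p*k]/p≡m/p+k : ∀ m k → (m + p * k) / p ≡ m / p + k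
  [m+p*k]/p≡m/p+k m k = begin
    (m + p * k) / p  ≡⟨ /-congˡ (cong (m +_) (*-comm p k)) ⟩
    (m + k * p) / p  ≡⟨ +-distrib-/-∣ʳ m (divides k refl) ⟩
    m / p + k * p / p  ≡⟨ cong (m / p +_) (m*n/n≡m k p) ⟩
    m / p + k  ∎
    where open ≡-Reasoning

  [m+p*k]%p≡m%p : ∀ m k → (m + p * k) % p ≡ m % p
  [m+p*k]%p≡m%p m k = trans (%-congˡ (cong (m +_) (*-comm p k))) ([m+kn]%n≡m%n m k p)

  [m+p*k]%p≡m : ∀ m k → m < p → (m + p * k) % p ≡ m
  [m+p*k]%p≡m m k m<p = trans ([m+p*k]%p≡m%p m k) (m<n⇒m%n≡m m<p)

  [m+p*k]/p≡k : ∀ m k → m < p → (m + p * k) / p ≡ k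
  [m+p*k]/p≡k m k m<p = trans ([m+p*k]/p≡m/p+k m k) (cong (_+ k) (m<n⇒m/n≡0 m<p))

  shift-/ : ∀ j N → shift pr j (N / p) ≡ shift pr j N / p
  shift-/ zero    N = refl
  shift-/ (suc j) N = cong (_/ p) (shift-/ j N)

  digit-suc : ∀ j N → digit pr (suc j) N ≡ digit pr j (N / p)
  digit-suc j N = cong (_% p) (sym (shift-/ j N))

  shift-+ : ∀ j t N → shift pr (j + t) N ≡ shift pr j (shift pr t N)
  shift-+ zero    t N = refl
  shift-+ (suc j) t N = cong (_/ p) (shift-+ j t N)

  shift-< : ∀ j c N → N < p ^ j * c → shift pr j N < c
  shift-< zero    c N N<c = subst (N <_) (+-identityʳ c) N<c
  shift-< (suc j) c N N<p^[1+j]c =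
    m<n*o⇒m/o<n (subst (shift pr j N <_) (*-comm p c) (shift-< j (p * c) N (subst (N <_) (assoc p (p ^ j) c) N<p^[1+j]c)))
    where
      assoc : ∀ x y z → x * y * z ≡ y * (x * z)
      assoc = solve-∀

  shift-small : ∀ j N → N < p ^ j → shift pr j N ≡ 0
  shift-small j N N<p^j = n<1⇒n≡0 (shift-< j 1 N (subst (N <_) (sym (*-identityʳ _)) N<p^j))

  digit-small : ∀ j N → N < p ^ j → digit pr j N ≡ 0
  digit-small j N N<p^j = trans (cong (_% p) (shift-small j N N<p^j)) (m<n⇒m%n≡m (<-trans z<s 1<p))

  digit-0 : ∀ j → digit pr j 0 ≡ 0
  digit-0 j = digit-small j 0 (m^n>0 p j)

  p^[1+t∸j]*b : ∀ {j t} b → j ≤ t → p ^ (suc t ∸ j) * b ≡ p * (p ^ (t ∸ j) * b)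
  p^[1+t∸j]*b {j} {t} b j≤t = trans (cong (λ e → p ^ e * b) (+-∸-assoc 1 j≤t)) (*-assoc p (p ^ (t ∸ j)) b)

  shift-+-^* : ∀ j t a b → j ≤ t → shift pr j (a + p ^ t * b) ≡ shift pr j a + p ^ (t ∸ j) * b
  shift-+-^* zero    t       a b _         = refl
  shift-+-^* (suc j) (suc t) a b (s≤s j≤t) = begin
    shift pr j (a + p ^ suc t * b) / p          ≡⟨ cong (_/ p) (shift-+-^* j (suc t) a b (m≤n⇒m≤1+n j≤t)) ⟩
    (shift pr j a + p ^ (suc t ∸ j) * b) / p    ≡⟨ cong (λ e → (shift pr j a + e) / p) (p^[1+t∸j]*b b j≤t) ⟩
    (shift pr j a + p * (p ^ (t ∸ j) * b)) / p  ≡⟨ [m+p*k]/p≡m/p+k (shift pr j a) _ ⟩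
    shift pr j a / p + p ^ (t ∸ j) * b          ∎
    where open ≡-Reasoning

  digit-+-^*-low : ∀ j t a b → j < t → digit pr j (a + p ^ t * b) ≡ digit pr j a
  digit-+-^*-low j (suc t) a b (s≤s j≤t) = begin
    shift pr j (a + p ^ suc t * b) % p          ≡⟨ cong (_% p) (shift-+-^* j (suc t) a b (m≤n⇒m≤1+n j≤t)) ⟩
    (shift pr j a + p ^ (suc t ∸ j) * b) % p    ≡⟨ cong (λ e → (shift pr j a + e) % p) (p^[1+t∸j]*b b j≤t) ⟩
    (shift pr j a + p * (p ^ (t ∸ j) * b)) % p  ≡⟨ [m+p*k]%p≡m%p (shift pr j a) _ ⟩
    shift pr j a % p                            ∎
    where open ≡-Reasoning

  digit-+-^*-high : ∀ j t a b → a < p ^ t → digit pr (j + t) (a + p ^ t * b) ≡ digit pr j b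
  digit-+-^*-high j t a b a<p^t = cong (_% p) (begin
    shift pr (j + t) (a + p ^ t * b)            ≡⟨ shift-+ j t _ ⟩
    shift pr j (shift pr t (a + p ^ t * b))     ≡⟨ cong (shift pr j) (shift-+-^* t t a b ≤-refl) ⟩
    shift pr j (shift pr t a + p ^ (t ∸ t) * b)
      ≡⟨ cong₂ (λ x y → shift pr j (x + p ^ y * b)) (shift-small t a a<p^t) (n∸n≡0 t) ⟩
    shift pr j (p ^ 0 * b)                      ≡⟨ cong (shift pr j) (*-identityˡ b) ⟩
    shift pr j b                                ∎)
    where open ≡-Reasoning

  digit-+ : ∀ x y → (∀ j → digit pr j x + digit pr j y < p) →
    ∀ j → digit pr j (x + y) ≡ digit pr j x + digit pr j y
  digit-+ x y noCarry zero    = trans (%-distribˡ-+ x y p) (m<n⇒m%n≡m (noCarry 0))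
  digit-+ x y noCarry (suc j) = begin
    digit pr (suc j) (x + y)          ≡⟨ digit-suc j (x + y) ⟩
    digit pr j ((x + y) / p)          ≡⟨ cong (digit pr j) (+-distrib-/ x y (noCarry 0)) ⟩
    digit pr j (x / p + y / p)        ≡⟨ digit-+ (x / p) (y / p) noCarry′ j ⟩
    digit pr j (x / p) + digit pr j (y / p)  ≡⟨ sym (cong₂ _+_ (digit-suc j x) (digit-suc j y)) ⟩
    digit pr (suc j) x + digit pr (suc j) y  ∎
    where
      open ≡-Reasoning
      noCarry′ : ∀ k → digit pr k (x / p) + digit pr k (y / p) < p
      noCarry′ k = subst₂ (λ a b → a + b < p) (digit-suc k x) (digit-suc k y) (noCarry (suc k))

  digit-^-≡ : ∀ i → digit pr i (p ^ i) ≡ 1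
  digit-^-≡ i = begin
    digit pr i (p ^ i)                ≡⟨ cong (digit pr i) (sym (*-identityʳ (p ^ i))) ⟩
    digit pr (0 + i) (0 + p ^ i * 1)  ≡⟨ digit-+-^*-high 0 i 0 1 (m^n>0 p i) ⟩
    digit pr 0 1                      ≡⟨ m<n⇒m%n≡m 1<p ⟩
    1                                 ∎
    where open ≡-Reasoning

  digit-^-≢ : ∀ {j i} → j ≢ i → digit pr j (p ^ i) ≡ 0
  digit-^-≢ {j} {i} j≢i with <-cmp j i
  ... | tri< j<i _ _ = trans (cong (digit pr j) (sym (*-identityʳ (p ^ i))))
                             (trans (digit-+-^*-low j i 0 1 j<i) (digit-0 j))
  ... | tri≈ _ j≡i _ = ⊥-elim (j≢i j≡i)
  ... | tri> _ _ j>i with m≤n⇒∃[o]m+o≡n (<⇒≤ j>i)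
  ...   | suc d , refl = begin
    digit pr (i + suc d) (p ^ i)        ≡⟨ cong₂ (digit pr) (+-comm i (suc d)) (sym (*-identityʳ (p ^ i))) ⟩
    digit pr (suc d + i) (0 + p ^ i * 1) ≡⟨ digit-+-^*-high (suc d) i 0 1 (m^n>0 p i) ⟩
    digit pr (suc d) 1                   ≡⟨ digit-small (suc d) 1 (^-monoʳ-< p 1<p {0} {suc d} z<s) ⟩
    0                                    ∎
    where open ≡-Reasoning
  ...   | zero , i+0≡j = ⊥-elim (<-irrefl (trans (sym (+-identityʳ i)) i+0≡j) j>i)

  digit-^*-low : ∀ j t b → j < t → digit pr j (p ^ t * b) ≡ 0
  digit-^*-low j t b j<t = trans (digit-+-^*-low j t 0 b j<t) (digit-0 j)

  digit-^*-high : ∀ j t b → digit pr (j + t) (p ^ t * b) ≡ digit pr j b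
  digit-^*-high j t b = digit-+-^*-high j t 0 b (m^n>0 p t)

  NoCarry : ∀ {n} → Vec ℕ n → Set
  NoCarry X = ∀ j → Vec.sum (Vec.map (digit pr j) X) < p

  noCarry-tail : ∀ {n} x (X : Vec ℕ n) → NoCarry (x ∷ X) → NoCarry X
  noCarry-tail x X noCarry j = ≤-<-trans (m≤n+m _ (digit pr j x)) (noCarry j)

  digit-sum : ∀ {n} (X : Vec ℕ n) → NoCarry X → ∀ j → digit pr j (Vec.sum X) ≡ Vec.sum (Vec.map (digit pr j) X)
  digit-sum []      _       j = digit-0 j
  digit-sum (x ∷ X) noCarry j =
    trans (digit-+ x (Vec.sum X) noCarry′ j) (cong (digit pr j x +_) (digit-sum X (noCarry-tail x X noCarry) j))
    where
      noCarry′ : ∀ j → digit pr j x + digit pr j (Vec.sum X) < p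
      noCarry′ j = subst (λ e → digit pr j x + e < p) (sym (digit-sum X (noCarry-tail x X noCarry) j)) (noCarry j)

  sum-digits-^*-low : ∀ {n} j t (X : Vec ℕ n) → j < t → Vec.sum (Vec.map (digit pr j) (Vec.map (p ^ t *_) X)) ≡ 0
  sum-digits-^*-low j t []      j<t = refl
  sum-digits-^*-low j t (x ∷ X) j<t = cong₂ _+_ (digit-^*-low j t x j<t) (sum-digits-^*-low j t X j<t)

  sum-digits-^*-high : ∀ {n} j t (X : Vec ℕ n) → t ≤ j →
    Vec.sum (Vec.map (digit pr j) (Vec.map (p ^ t *_) X)) ≡ Vec.sum (Vec.map (digit pr (j ∸ t)) X)
  sum-digits-^*-high j t []      t≤j = refl
  sum-digits-^*-high j t (x ∷ X) t≤j = cong₂ _+_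
    (trans (cong (λ i → digit pr i (p ^ t * x)) (sym (m∸n+n≡m t≤j))) (digit-^*-high (j ∸ t) t x))
    (sum-digits-^*-high j t X t≤j)

infixl 7 _⋅_
infixl 6 _⊕_ _⊖_
infix 4 _≤ᵛ_

_⊕_ _⊖_ : ∀ {n} → Vector ℕ n → Vector ℕ n → Vector ℕ n
_⊕_ = zipWith _+_
_⊖_ = zipWith _∸_

_⋅_ : ∀ {n} → ℕ → Vector ℕ n → Vector ℕ n
(c ⋅ u) i = c * u i

_≤ᵛ_ : ∀ {n} → Vector ℕ n → Vector ℕ n → Set
_≤ᵛ_ = Pointwise _≤_

𝟘 : ∀ {n} → Vector ℕ n
𝟘 _ = 0

⊖-≤-⊕ : ∀ {n} {u v : Vector ℕ n} → v ≤ᵛ u → u ⊖ v ⊕ v ≗ u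
⊖-≤-⊕ v≤u i = m∸n+n≡m (v≤u i)

⊖⊕-additive : ∀ {n} (f : Vector ℕ n → ℕ) →
  (∀ u v → f (u ⊕ v) ≡ f u + f v) → (∀ {u v} → u ≗ v → f u ≡ f v) →
  ∀ {y a} b → a ≤ᵛ y → f (y ⊖ a ⊕ b) + f a ≡ f y + f b
⊖⊕-additive f f-⊕ f-cong {y} {a} b a≤y = begin
  f (y ⊖ a ⊕ b) + f a    ≡⟨ cong (_+ f a) (f-⊕ (y ⊖ a) b) ⟩
  f (y ⊖ a) + f b + f a  ≡⟨ xy∙z≈xz∙y (f (y ⊖ a)) (f b) (f a) ⟩
  f (y ⊖ a) + f a + f b  ≡⟨ cong (_+ f b) (trans (sym (f-⊕ (y ⊖ a) a)) (f-cong (⊖-≤-⊕ a≤y))) ⟩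
  f y + f b              ∎
  where open ≡-Reasoning

⊕-split : ∀ {n} {a b v : Vector ℕ n} → v ≤ᵛ a ⊕ b →
  ∃₂ λ α β → α ≤ᵛ a × β ≤ᵛ b × α ⊕ β ≗ v
⊕-split {a = a} {b} {v} v≤a+b = α , β , α≤a , β≤b , α+β≡v
  where
    α β : Vector ℕ _
    α i = a i ⊓ v i
    β i = v i ∸ a i
    α≤a : α ≤ᵛ a
    α≤a i = m⊓n≤m (a i) (v i)
    β≤b : β ≤ᵛ b
    β≤b i = subst (v i ∸ a i ≤_) (m+n∸m≡n (a i) (b i)) (∸-monoˡ-≤ (a i) (v≤a+b i))
    α+β≡v : α ⊕ β ≗ v
    α+β≡v i = m⊓n+n∸m≡n (a i) (v i)

∑ : ∀ {n} → List (Vector ℕ n) → Vector ℕ n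
∑ []       = 𝟘
∑ (u ∷ us) = u ⊕ ∑ us

lookup-≗⇒≡ : ∀ {A : Set} {n} {xs ys : Vec A n} → Vec.lookup xs ≗ Vec.lookup ys → xs ≡ ys
lookup-≗⇒≡ {xs = xs} {ys} xs≗ys = trans (sym (tabulate∘lookup xs)) (trans (tabulate-cong xs≗ys) (tabulate∘lookup ys))

Nonzero : ∀ {n} → Vector ℕ n → Set
Nonzero = Any (0 <_)

nonzero-or-𝟘 : ∀ {n} (u : Vector ℕ n) → Nonzero u ⊎ u ≗ 𝟘
nonzero-or-𝟘 u with any (0 <?_) u
... | yes u≢𝟘 = inj₁ u≢𝟘
... | no  u≡𝟘 = inj₂ (λ i → n≤0⇒n≡0 (≮⇒≥ (λ 0<uᵢ → u≡𝟘 (i , 0<uᵢ))))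

Nonzero-mono : ∀ {n} {u v : Vector ℕ n} → u ≤ᵛ v → Nonzero u → Nonzero v
Nonzero-mono u≤v (i , 0<uᵢ) = i , <-≤-trans 0<uᵢ (u≤v i)

Nonzero-resp-≗ : ∀ {n} {u v : Vector ℕ n} → u ≗ v → Nonzero u → Nonzero v
Nonzero-resp-≗ u≗v = Nonzero-mono (≤-reflexive ∘ u≗v)

Nonzero-⊕ˡ : ∀ {n} {u : Vector ℕ n} v → Nonzero u → Nonzero (u ⊕ v)
Nonzero-⊕ˡ v = Nonzero-mono (λ i → m≤m+n _ (v i))

Nonzero-⊕ʳ : ∀ {n} u {v : Vector ℕ n} → Nonzero v → Nonzero (u ⊕ v)
Nonzero-⊕ʳ u = Nonzero-mono (λ i → m≤n+m _ (u i))

unit : ∀ {n} → Fin n → Vector ℕ n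
unit i j = if does (j ≟ᶠ i) then 1 else 0

unit-self : ∀ {n} (i : Fin n) → unit i i ≡ 1
unit-self i rewrite dec-true (i ≟ᶠ i) refl = refl

unit-other : ∀ {n} {i j : Fin n} → j ≢ i → unit i j ≡ 0
unit-other {i = i} {j} j≢i rewrite dec-false (j ≟ᶠ i) j≢i = refl

⋅unit≤ : ∀ {n} {y : Vector ℕ n} {i c} → c ≤ y i → c ⋅ unit i ≤ᵛ y
⋅unit≤ {y = y} {i} {c} c≤yᵢ j with j ≟ᶠ i
... | yes refl = subst (_≤ y j) (sym (*-identityʳ c)) c≤yᵢ
... | no  _    = subst (_≤ y j) (sym (*-zeroʳ c)) z≤n

unit≤ : ∀ {n} {y : Vector ℕ n} {i} → 0 < y i → unit i ≤ᵛ y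
unit≤ {y = y} {i} 0<yᵢ j with j ≟ᶠ i
... | yes refl = 0<yᵢ
... | no  _    = z≤n

entrySum : ∀ {n} → Vector ℕ n → ℕ
entrySum {zero}  u = 0
entrySum {suc n} u = head u + entrySum (tail u)

entrySum-cong : ∀ {n} {u v : Vector ℕ n} → u ≗ v → entrySum u ≡ entrySum v
entrySum-cong {zero}  u≗v = refl
entrySum-cong {suc n} u≗v = cong₂ _+_ (u≗v fzero) (entrySum-cong (u≗v ∘ fsuc))

entrySum-⊕ : ∀ {n} (u v : Vector ℕ n) → entrySum (u ⊕ v) ≡ entrySum u + entrySum v
entrySum-⊕ {zero}  u v = refl
entrySum-⊕ {suc n} u v =
  trans (cong (head u + head v +_) (entrySum-⊕ (tail u) (tail v))) (interchange (head u) (head v) _ _)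

entrySum-⋅ : ∀ {n} c (u : Vector ℕ n) → entrySum (c ⋅ u) ≡ c * entrySum u
entrySum-⋅ {zero}  c u = sym (*-zeroʳ c)
entrySum-⋅ {suc n} c u = trans (cong (c * head u +_) (entrySum-⋅ c (tail u))) (sym (*-distribˡ-+ c (head u) _))

entrySum-𝟘 : ∀ n → entrySum {n} 𝟘 ≡ 0
entrySum-𝟘 zero    = refl
entrySum-𝟘 (suc n) = entrySum-𝟘 n

entrySum-unit : ∀ {n} (i : Fin n) → entrySum (unit i) ≡ 1
entrySum-unit {suc n} fzero    = cong suc (entrySum-𝟘 n)
entrySum-unit {suc n} (fsuc i) = entrySum-unit i

count : ∀ {n} → List (Fin n) → Vector ℕ n
count []       = 𝟘
count (i ∷ is) = unit i ⊕ count is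

count-++ : ∀ {n} (is js : List (Fin n)) → count (is ++ js) ≗ count is ⊕ count js
count-++ []       js j = refl
count-++ (i ∷ is) js j = trans (cong (unit i j +_) (count-++ is js j)) (sym (+-assoc (unit i j) _ _))

head-count-replicate : ∀ {n} k → head (count (replicateᴸ k (fzero {n}))) ≡ k
head-count-replicate zero    = refl
head-count-replicate (suc k) = cong suc (head-count-replicate k)

tail-count-replicate : ∀ {n} k → tail (count (replicateᴸ k (fzero {n}))) ≗ 𝟘
tail-count-replicate zero    j = refl
tail-count-replicate (suc k) j = tail-count-replicate k j

head-count-map-suc : ∀ {n} (is : List (Fin n)) → head (count (map fsuc is)) ≡ 0
head-count-map-suc []       = refl
head-count-map-suc (i ∷ is) = head-count-map-suc is

tail-count-map-suc : ∀ {n} (is : List (Fin n)) → tail (count (map fsuc is)) ≗ count is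
tail-count-map-suc []       j = refl
tail-count-map-suc (i ∷ is) j = cong (unit i j +_) (tail-count-map-suc is j)

units : ∀ {n} → Vector ℕ n → List (Fin n)
units {zero}  u = []
units {suc n} u = replicateᴸ (head u) fzero ++ map fsuc (units (tail u))

count-units : ∀ {n} (u : Vector ℕ n) → count (units u) ≗ u
count-units {suc n} u fzero = begin
  count (units u) fzero  ≡⟨ count-++ (replicateᴸ (head u) fzero) _ fzero ⟩
  count (replicateᴸ (head u) fzero) fzero + count (map fsuc (units (tail u))) fzero
    ≡⟨ cong₂ _+_ (head-count-replicate (head u)) (head-count-map-suc (units (tail u))) ⟩
  head u + 0  ≡⟨ +-identityʳ (head u) ⟩
  head u  ∎
  where open ≡-Reasoning
count-units {suc n} u (fsuc j) = begin
  count (units u) (fsuc j)  ≡⟨ count-++ (replicateᴸ (head u) fzero) _ (fsuc j) ⟩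
  count (replicateᴸ (head u) fzero) (fsuc j) + count (map fsuc (units (tail u))) (fsuc j)
    ≡⟨ cong₂ _+_ (tail-count-replicate (head u) j) (tail-count-map-suc (units (tail u)) j) ⟩
  count (units (tail u)) j  ≡⟨ count-units (tail u) j ⟩
  u (fsuc j)  ∎
  where open ≡-Reasoning

module Value {p : ℕ} (pr : Prime p) where

  open Digits pr

  value : ∀ {n} → Vector ℕ n → ℕ
  value {zero}  u = 0
  value {suc n} u = head u + p * value (tail u)

  ρᵛ : ∀ {n} → Vector ℕ n
  ρᵛ _ = p ∸ 1

  digits : ∀ n → ℕ → Vector ℕ n
  digits n a i = digit pr (toℕ i) a

  ≤p∸1⇒<p : ∀ {a} → a ≤ p ∸ 1 → a < p
  ≤p∸1⇒<p a≤p∸1 = ≤-trans (s≤s a≤p∸1) (≤-reflexive (trans (+-comm 1 (p ∸ 1)) (m∸n+n≡m (<⇒≤ 1<p))))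

  value-cong : ∀ {n} {u v : Vector ℕ n} → u ≗ v → value u ≡ value v
  value-cong {zero}  u≗v = refl
  value-cong {suc n} u≗v = cong₂ _+_ (u≗v fzero) (cong (p *_) (value-cong (u≗v ∘ fsuc)))

  value-⊕ : ∀ {n} (u v : Vector ℕ n) → value (u ⊕ v) ≡ value u + value v
  value-⊕ {zero}  u v = refl
  value-⊕ {suc n} u v = begin
    head u + head v + p * value (tail u ⊕ tail v)
      ≡⟨ cong (λ x → head u + head v + p * x) (value-⊕ (tail u) (tail v)) ⟩
    head u + head v + p * (value (tail u) + value (tail v))
      ≡⟨ cong (head u + head v +_) (*-distribˡ-+ p (value (tail u)) _) ⟩
    head u + head v + (p * value (tail u) + p * value (tail v))
      ≡⟨ interchange (head u) (head v) _ _ ⟩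
    head u + p * value (tail u) + (head v + p * value (tail v))  ∎
    where open ≡-Reasoning

  value-⊖ : ∀ {n} {u v : Vector ℕ n} → v ≤ᵛ u → value (u ⊖ v) + value v ≡ value u
  value-⊖ {u = u} {v} v≤u = trans (sym (value-⊕ (u ⊖ v) v)) (value-cong (⊖-≤-⊕ v≤u))

  value-⋅ : ∀ {n} c (u : Vector ℕ n) → value (c ⋅ u) ≡ c * value u
  value-⋅ {zero}  c u = sym (*-zeroʳ c)
  value-⋅ {suc n} c u = begin
    c * head u + p * value (c ⋅ tail u)  ≡⟨ cong (λ x → c * head u + p * x) (value-⋅ c (tail u)) ⟩
    c * head u + p * (c * value (tail u))  ≡⟨ cong (c * head u +_) (x*[y*z]≡y*[x*z] p c _) ⟩
    c * head u + c * (p * value (tail u))  ≡⟨ sym (*-distribˡ-+ c (head u) _) ⟩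
    c * (head u + p * value (tail u))  ∎
    where
      open ≡-Reasoning
      x*[y*z]≡y*[x*z] : ∀ x y z → x * (y * z) ≡ y * (x * z)
      x*[y*z]≡y*[x*z] = solve-∀

  value-𝟘 : ∀ n → value {n} 𝟘 ≡ 0
  value-𝟘 zero    = refl
  value-𝟘 (suc n) = trans (cong (p *_) (value-𝟘 n)) (*-zeroʳ p)

  value-mono : ∀ {n} {u v : Vector ℕ n} → u ≤ᵛ v → value u ≤ value v
  value-mono {zero}  u≤v = z≤n
  value-mono {suc n} u≤v = +-mono-≤ (u≤v fzero) (*-monoʳ-≤ p (value-mono (u≤v ∘ fsuc)))

  value-unit : ∀ {n} (i : Fin n) → value (unit i) ≡ p ^ toℕ i
  value-unit {suc n} fzero    = cong suc (trans (cong (p *_) (value-𝟘 n)) (*-zeroʳ p))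
  value-unit {suc n} (fsuc i) = cong (p *_) (value-unit i)

  value-ρᵛ : ∀ n → value {n} ρᵛ + 1 ≡ p ^ n
  value-ρᵛ zero    = refl
  value-ρᵛ (suc n) = begin
    p ∸ 1 + p * value {n} ρᵛ + 1    ≡⟨ shuffle (p ∸ 1) p (value {n} ρᵛ) ⟩
    p * value {n} ρᵛ + (p ∸ 1 + 1)  ≡⟨ cong (p * value {n} ρᵛ +_) (m∸n+n≡m (<⇒≤ 1<p)) ⟩
    p * value {n} ρᵛ + p            ≡⟨ +-comm _ p ⟩
    p + p * value {n} ρᵛ            ≡⟨ sym (*-suc p _) ⟩
    p * suc (value {n} ρᵛ)          ≡⟨ cong (p *_) (trans (+-comm 1 _) (value-ρᵛ n)) ⟩
    p * p ^ n                       ∎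
    where
      open ≡-Reasoning
      shuffle : ∀ a q x → a + q * x + 1 ≡ q * x + (a + 1)
      shuffle = solve-∀

  value-positive : ∀ {n} {u : Vector ℕ n} → Nonzero u → 0 < value u
  value-positive {suc n} (fzero , 0<u₀)  = ≤-trans 0<u₀ (m≤m+n _ _)
  value-positive {suc n} {u} (fsuc i , 0<uᵢ) =
    ≤-trans (*-mono-< (<-trans z<s 1<p) (value-positive {u = tail u} (i , 0<uᵢ))) (m≤n+m _ (head u))

  positive-value : ∀ {n} (u : Vector ℕ n) → 0 < value u → Nonzero u
  positive-value {n} u 0<value with nonzero-or-𝟘 u
  ... | inj₁ u≢𝟘 = u≢𝟘
  ... | inj₂ u≗𝟘 = ⊥-elim (<-irrefl (sym (trans (value-cong u≗𝟘) (value-𝟘 n))) 0<value)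

  value-injective : ∀ {n} {u v : Vector ℕ n} → u ≤ᵛ ρᵛ → v ≤ᵛ ρᵛ → value u ≡ value v → u ≗ v
  value-injective {suc n} {u} {v} u≤ρ v≤ρ eq fzero = begin
    head u                             ≡⟨ sym ([m+p*k]%p≡m (head u) _ (≤p∸1⇒<p (u≤ρ fzero))) ⟩
    (head u + p * value (tail u)) % p  ≡⟨ %-congˡ eq ⟩
    (head v + p * value (tail v)) % p  ≡⟨ [m+p*k]%p≡m (head v) _ (≤p∸1⇒<p (v≤ρ fzero)) ⟩
    head v                             ∎
    where open ≡-Reasoning
  value-injective {suc n} {u} {v} u≤ρ v≤ρ eq (fsuc i) =
    value-injective (u≤ρ ∘ fsuc) (v≤ρ ∘ fsuc) (begin
      value (tail u)                     ≡⟨ sym ([m+p*k]/p≡k (head u) _ (≤p∸1⇒<p (u≤ρ fzero))) ⟩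
      (head u + p * value (tail u)) / p  ≡⟨ /-congˡ eq ⟩
      (head v + p * value (tail v)) / p  ≡⟨ [m+p*k]/p≡k (head v) _ (≤p∸1⇒<p (v≤ρ fzero)) ⟩
      value (tail v)                     ∎) i
    where open ≡-Reasoning

  value-digits : ∀ n a → a < p ^ n → value (digits n a) ≡ a
  value-digits zero    a a<1 = sym (n<1⇒n≡0 a<1)
  value-digits (suc n) a a<p^[1+n] = begin
    a % p + p * value (tail (digits (suc n) a))
      ≡⟨ cong (λ x → a % p + p * x) (trans (value-cong {n} (λ i → digit-suc (toℕ i) a)) (value-digits n (a / p) a/p<p^n)) ⟩
    a % p + p * (a / p)  ≡⟨ cong (a % p +_) (*-comm p (a / p)) ⟩
    a % p + a / p * p    ≡⟨ sym (m≡m%n+[m/n]*n a p) ⟩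
    a                    ∎
    where
      open ≡-Reasoning
      a/p<p^n : a / p < p ^ n
      a/p<p^n = m<n*o⇒m/o<n (subst (a <_) (*-comm p (p ^ n)) a<p^[1+n])

module Period {p : ℕ} (pr : Prime p) (s′ : ℕ) where

  open Digits pr

  s : ℕ
  s = suc s′

  instance
    p^s-nonZero : NonZero (p ^ s)
    p^s-nonZero = m^n≢0 p s

  open Modulo (M p s) public

  p^s≡1+M : p ^ s ≡ suc (M p s)
  p^s≡1+M = sym (trans (+-comm 1 (p ^ s ∸ 1)) (m∸n+n≡m (m^n>0 p s)))

  p^s*≈ : ∀ a → p ^ s * a ≈ a
  p^s*≈ a = subst (λ q → q * a ≈ a) (sym p^s≡1+M) (suc-*-≈ a)

module Γ-vectors {p : ℕ} (pr : Prime p) (s′ : ℕ) where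

  open Digits pr
  open Value pr
  open Period pr s′

  blockDigit : ℕ → Fin s → ℕ → ℕ
  blockDigit N i q = digit pr (toℕ i + q * s) N

  digitSum : ℕ → ℕ → Vector ℕ s
  digitSum L N i = sum (applyUpTo (blockDigit N i) L)

  Γᵛ : ℕ → Vector ℕ s
  Γᵛ N = digitSum (suc N) N

  lookup-Γ : ∀ N → Vec.lookup (Γ pr s N) ≗ Γᵛ N
  lookup-Γ N i = trans (lookup∘tabulate (λ i → sum (map (blockDigit N i) (upTo (suc N)))) i)
    (cong sum (map-applyUpTo (blockDigit N i) id (suc N)))

  Γ≡⇒≗ : ∀ {N u} → Γ pr s N ≡ u → Γᵛ N ≗ Vec.lookup u
  Γ≡⇒≗ {N} refl i = sym (lookup-Γ N i)

  ≗⇒Γ≡ : ∀ {N u} → Γᵛ N ≗ Vec.lookup u → Γ pr s N ≡ u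
  ≗⇒Γ≡ {N} Γᵛ≗u = lookup-≗⇒≡ (λ i → trans (lookup-Γ N i) (Γᵛ≗u i))

  digitSum-stable : ∀ {N L} → N ≤ L → digitSum L N ≗ Γᵛ N
  digitSum-stable {N} {L} N≤L i = trans (vanish N≤L) (sym (vanish (n≤1+n N)))
    where
      N<p^ : ∀ q → N ≤ q → N < p ^ (toℕ i + q * s)
      N<p^ q N≤q = <-≤-trans (n<p^n N) (^-monoʳ-≤ p (≤-trans N≤q (≤-trans (m≤m*n q s) (m≤n+m _ (toℕ i)))))
      vanish : ∀ {L} → N ≤ L → sum (applyUpTo (blockDigit N i) L) ≡ sum (applyUpTo (blockDigit N i) N)
      vanish {L} N≤L = sum-applyUpTo-vanishing N L (blockDigit N i) N≤L (λ q N≤q → digit-small (toℕ i + q * s) N (N<p^ q N≤q))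

  Γᵛ-0 : Γᵛ 0 ≗ 𝟘
  Γᵛ-0 i = cong (_+ 0) (digit-0 (toℕ i + 0))

  Γᵛ-block : ∀ a b → a < p ^ s → Γᵛ (a + p ^ s * b) ≗ digits s a ⊕ Γᵛ b
  Γᵛ-block a b a<p^s i =
    cong₂ _+_ first (trans (sum-applyUpTo-cong N {blockDigit N i ∘ suc} {blockDigit b i} rest) (digitSum-stable b≤N i))
    where
      N = a + p ^ s * b
      first : digit pr (toℕ i + 0 * s) N ≡ digit pr (toℕ i) a
      first = trans (cong (λ j → digit pr j N) (+-identityʳ (toℕ i))) (digit-+-^*-low (toℕ i) s a b (toℕ<n i))
      rest : ∀ q → digit pr (toℕ i + suc q * s) N ≡ digit pr (toℕ i + q * s) b
      rest q = trans (cong (λ j → digit pr j N) (shuffle (toℕ i) q s)) (digit-+-^*-high (toℕ i + q * s) s a b a<p^s)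
        where
          shuffle : ∀ x y z → x + (z + y * z) ≡ x + y * z + z
          shuffle = solve-∀
      b≤N : b ≤ N
      b≤N = ≤-trans (m≤n*m b (p ^ s)) (m≤n+m _ a)

  Γᵛ-+ : ∀ x y → (∀ j → digit pr j x + digit pr j y < p) → Γᵛ (x + y) ≗ Γᵛ x ⊕ Γᵛ y
  Γᵛ-+ x y noCarry i = begin
    Γᵛ (x + y) i
      ≡⟨ sum-applyUpTo-cong L {g = λ q → blockDigit x i q + blockDigit y i q} (λ q → digit-+ x y noCarry (toℕ i + q * s)) ⟩
    sum (applyUpTo (λ q → blockDigit x i q + blockDigit y i q) L)
      ≡⟨ sum-applyUpTo-+ L (blockDigit x i) (blockDigit y i) ⟩
    digitSum L x i + digitSum L y i
      ≡⟨ cong₂ _+_ (digitSum-stable (≤-trans (m≤m+n x y) (n≤1+n _)) i)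
                   (digitSum-stable (≤-trans (m≤n+m y x) (n≤1+n _)) i) ⟩
    Γᵛ x i + Γᵛ y i  ∎
    where
      open ≡-Reasoning
      L = suc (x + y)

  Γᵛ-div-mod : ∀ N → Γᵛ N ≗ digits s (N % p ^ s) ⊕ Γᵛ (N / p ^ s)
  Γᵛ-div-mod N i = trans (cong (λ x → Γᵛ x i) N≡) (Γᵛ-block (N % p ^ s) (N / p ^ s) (m%n<n N (p ^ s)) i)
    where
      N≡ : N ≡ N % p ^ s + p ^ s * (N / p ^ s)
      N≡ = trans (m≡m%n+[m/n]*n N (p ^ s)) (cong (N % p ^ s +_) (*-comm (N / p ^ s) (p ^ s)))

  value-Γᵛ-div-mod : ∀ N → value (Γᵛ N) ≡ N % p ^ s + value (Γᵛ (N / p ^ s))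
  value-Γᵛ-div-mod N = begin
    value (Γᵛ N)                                          ≡⟨ value-cong (Γᵛ-div-mod N) ⟩
    value (digits s (N % p ^ s) ⊕ Γᵛ (N / p ^ s))         ≡⟨ value-⊕ (digits s (N % p ^ s)) (Γᵛ (N / p ^ s)) ⟩
    value (digits s (N % p ^ s)) + value (Γᵛ (N / p ^ s))
      ≡⟨ cong (_+ value (Γᵛ (N / p ^ s))) (value-digits s (N % p ^ s) (m%n<n N (p ^ s))) ⟩
    N % p ^ s + value (Γᵛ (N / p ^ s))                    ∎
    where open ≡-Reasoning

  N/p^s<N : ∀ {N} → 0 < N → N / p ^ s < N
  N/p^s<N {suc n} _ = m/n<m (suc n) (p ^ s) (^-monoʳ-< p 1<p {0} {s} z<s)

  value-Γᵛ : ∀ N → value (Γᵛ N) ≈ N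
  value-Γᵛ = <-rec (λ N → value (Γᵛ N) ≈ N) step
    where
      step : ∀ N → (∀ {m} → m < N → value (Γᵛ m) ≈ m) → value (Γᵛ N) ≈ N
      step zero    _   = ≡⇒≈ (trans (value-cong Γᵛ-0) (value-𝟘 s))
      step N@(suc _) rec = begin
        value (Γᵛ N)                         ≡⟨ value-Γᵛ-div-mod N ⟩
        N % p ^ s + value (Γᵛ (N / p ^ s))   ≈⟨ +-cong (≡⇒≈ refl) (rec (N/p^s<N z<s)) ⟩
        N % p ^ s + N / p ^ s                ≈⟨ +-cong (≡⇒≈ refl) (≈-sym (p^s*≈ (N / p ^ s))) ⟩
        N % p ^ s + p ^ s * (N / p ^ s)      ≡⟨ cong (N % p ^ s +_) (*-comm (p ^ s) (N / p ^ s)) ⟩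
        N % p ^ s + N / p ^ s * p ^ s        ≡⟨ sym (m≡m%n+[m/n]*n N (p ^ s)) ⟩
        N                                    ∎
        where open ≈-Reasoning

  Γᵛ-nonzero : ∀ {N} → 0 < N → Nonzero (Γᵛ N)
  Γᵛ-nonzero {N} = <-rec (λ N → 0 < N → Nonzero (Γᵛ N)) step N
    where
      step : ∀ N → (∀ {m} → m < N → 0 < m → Nonzero (Γᵛ m)) → 0 < N → Nonzero (Γᵛ N)
      step N rec 0<N with N / p ^ s in N/p^s≡q
      ... | zero  = Nonzero-resp-≗ (λ i → sym (Γᵛ-div-mod N i))
                      (Nonzero-⊕ˡ (Γᵛ (N / p ^ s)) (positive-value (digits s (N % p ^ s)) 0<value))
        where
          0<value : 0 < value (digits s (N % p ^ s))
          0<value = subst (0 <_) (sym (trans (value-digits s _ (m%n<n N (p ^ s)))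
                      (m<n⇒m%n≡m (m/n≡0⇒m<n N/p^s≡q)))) 0<N
      ... | suc q =
        Nonzero-resp-≗ (λ i → sym (trans (Γᵛ-div-mod N i) (cong (λ x → digits s (N % p ^ s) i + Γᵛ x i) N/p^s≡q)))
                      (Nonzero-⊕ʳ (digits s (N % p ^ s)) (rec (subst (_< N) N/p^s≡q (N/p^s<N 0<N)) z<s))

  Γᵛ-nonzero⁻¹ : ∀ {N} → Nonzero (Γᵛ N) → 0 < N
  Γᵛ-nonzero⁻¹ {zero}  (i , 0<Γ₀ᵢ) = ⊥-elim (<-irrefl (sym (Γᵛ-0 i)) 0<Γ₀ᵢ)
  Γᵛ-nonzero⁻¹ {suc N} _ = z<s

  digits-^ : ∀ (i : Fin s) → digits s (p ^ toℕ i) ≗ unit i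
  digits-^ i j with j ≟ᶠ i
  ... | yes refl = digit-^-≡ (toℕ i)
  ... | no  j≢i  = digit-^-≢ (j≢i ∘ toℕ-injective)

  encode : List (Fin s) → ℕ
  encode []       = 0
  encode (i ∷ is) = p ^ toℕ i + p ^ s * encode is

  Γᵛ-encode : ∀ is → Γᵛ (encode is) ≗ count is
  Γᵛ-encode []       = Γᵛ-0
  Γᵛ-encode (i ∷ is) j = trans (Γᵛ-block (p ^ toℕ i) (encode is) (^-monoʳ-< p 1<p (toℕ<n i)) j)
    (cong₂ _+_ (digits-^ i j) (Γᵛ-encode is j))

  encode-< : ∀ is → encode is < p ^ (s * length is)
  encode-< []       = subst (λ e → 0 < p ^ e) (sym (*-zeroʳ s)) z<s
  encode-< (i ∷ is) = begin-strict
    p ^ toℕ i + p ^ s * encode is            <⟨ +-monoˡ-< _ (^-monoʳ-< p 1<p (toℕ<n i)) ⟩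
    p ^ s + p ^ s * encode is                ≡⟨ sym (*-suc (p ^ s) (encode is)) ⟩
    p ^ s * suc (encode is)                  ≤⟨ *-monoʳ-≤ (p ^ s) (encode-< is) ⟩
    p ^ s * p ^ (s * length is)              ≡⟨ sym (^-distribˡ-+-* p s _) ⟩
    p ^ (s + s * length is)                  ≡⟨ cong (p ^_) (sym (*-suc s (length is))) ⟩
    p ^ (s * length (i ∷ is))                ∎
    where open ≤-Reasoning

  Γᵛ-surjective : ∀ d → ∃₂ λ k t → k < p ^ (s * t) × Γᵛ k ≗ d
  Γᵛ-surjective d = encode (units d) , length (units d) , encode-< (units d) ,
    λ j → trans (Γᵛ-encode (units d) j) (count-units d j)

  Γᵛ-shift : ∀ t k → Γᵛ (p ^ (s * t) * k) ≗ Γᵛ k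
  Γᵛ-shift zero    k i = cong (λ e → Γᵛ e i) (trans (cong (λ e → p ^ e * k) (*-zeroʳ s)) (*-identityˡ k))
  Γᵛ-shift (suc t) k i = begin
    Γᵛ (p ^ (s * suc t) * k) i            ≡⟨ cong (λ e → Γᵛ e i) (p^[s+st]k (s * suc t) (*-suc s t)) ⟩
    Γᵛ (0 + p ^ s * (p ^ (s * t) * k)) i  ≡⟨ Γᵛ-block 0 _ (m^n>0 p s) i ⟩
    digit pr (toℕ i) 0 + Γᵛ (p ^ (s * t) * k) i  ≡⟨ cong₂ _+_ (digit-0 (toℕ i)) (Γᵛ-shift t k i) ⟩
    Γᵛ k i                                ∎
    where
      open ≡-Reasoning
      p^[s+st]k : ∀ e → e ≡ s + s * t → p ^ e * k ≡ 0 + p ^ s * (p ^ (s * t) * k)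
      p^[s+st]k e refl = trans (cong (_* k) (^-distribˡ-+-* p s (s * t))) (*-assoc (p ^ s) _ k)

  Γᵛ-+-shift : ∀ t a k → a < p ^ (s * t) → Γᵛ (a + p ^ (s * t) * k) ≗ Γᵛ a ⊕ Γᵛ k
  Γᵛ-+-shift t a k a<p^T i = trans (Γᵛ-+ a (p ^ T * k) noCarry i) (cong (Γᵛ a i +_) (Γᵛ-shift t k i))
    where
      T = s * t
      noCarry : ∀ j → digit pr j a + digit pr j (p ^ T * k) < p
      noCarry j with j <? T
      ... | yes j<T = subst (_< p) (sym (trans (cong (digit pr j a +_) (digit-^*-low j T k j<T)) (+-identityʳ _))) (digit<p j a)
      ... | no  j≮T = subst (_< p) (sym (cong (_+ digit pr j (p ^ T * k)) (digit-small j a a<p^j))) (digit<p j _)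
        where
          a<p^j : a < p ^ j
          a<p^j = <-≤-trans a<p^T (^-monoʳ-≤ p (≮⇒≥ j≮T))

module Carrying {p : ℕ} (pr : Prime p) (s′ : ℕ) where

  open Digits pr
  open Value pr
  open Period pr s′

  next : Fin s → Fin s
  next i with suc (toℕ i) <? s
  ... | yes 1+i<s = fromℕ< 1+i<s
  ... | no  _     = fzero

  value-unit-next≈ : ∀ i → value (unit (next i)) ≈ value (p ⋅ unit i)
  value-unit-next≈ i = subst₂ _≈_ (sym (value-unit (next i))) (sym (trans (value-⋅ p (unit i)) (cong (p *_) (value-unit i))))
    (p^next≈ i)
    where
      p^next≈ : ∀ i → p ^ toℕ (next i) ≈ p * p ^ toℕ i
      p^next≈ i with suc (toℕ i) <? s
      ... | yes 1+i<s = ≡⇒≈ (cong (p ^_) (toℕ-fromℕ< 1+i<s))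
      ... | no  1+i≮s =
        ≈-sym (subst (λ e → p * p ^ e ≈ 1) (sym i≡s′) (≈-trans (≡⇒≈ (sym (*-identityʳ _))) (p^s*≈ 1)))
        where
          i≡s′ : toℕ i ≡ s′
          i≡s′ = ≤-antisym (≤-pred (toℕ<n i)) (≤-pred (≮⇒≥ 1+i≮s))

  Covers : Vector ℕ s → Vector ℕ s → Set
  Covers y w = ∀ τ → τ ≤ᵛ w → ∃ λ z → z ≤ᵛ y × value z ≈ value τ

  covers-refl : ∀ {y} → Covers y y
  covers-refl τ τ≤y = τ , τ≤y , ≡⇒≈ refl

  covers-trans : ∀ {y y′ w} → Covers y y′ → Covers y′ w → Covers y w
  covers-trans y≽y′ y′≽w τ τ≤w with y′≽w τ τ≤w
  ... | z′ , z′≤y′ , z′≈τ with y≽y′ z′ z′≤y′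
  ...   | z , z≤y , z≈z′ = z , z≤y , ≈-trans z≈z′ z′≈τ

  carry : Vector ℕ s → Fin s → Vector ℕ s
  carry y i = y ⊖ p ⋅ unit i ⊕ unit (next i)

  value-carry : ∀ {y} i → p ⋅ unit i ≤ᵛ y → value (carry y i) ≈ value y
  value-carry i pe≤y = +-cancelʳ (⊖⊕-additive value value-⊕ value-cong (unit (next i)) pe≤y) (≈-sym (value-unit-next≈ i))

  entrySum-carry : ∀ {y} i → p ⋅ unit i ≤ᵛ y → entrySum (carry y i) < entrySum y
  entrySum-carry {y} i pe≤y = +-cancelʳ-< p _ _ (begin-strict
    entrySum (carry y i) + p                   ≡⟨ cong (entrySum (carry y i) +_) (sym p⋅unit-entries) ⟩
    entrySum (carry y i) + entrySum (p ⋅ unit i) ≡⟨ ⊖⊕-additive entrySum entrySum-⊕ entrySum-cong (unit (next i)) pe≤y ⟩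
    entrySum y + entrySum (unit (next i))      ≡⟨ cong (entrySum y +_) (entrySum-unit (next i)) ⟩
    entrySum y + 1                             <⟨ +-monoʳ-< (entrySum y) 1<p ⟩
    entrySum y + p                             ∎)
    where
      open ≤-Reasoning
      p⋅unit-entries : entrySum (p ⋅ unit i) ≡ p
      p⋅unit-entries = trans (entrySum-⋅ p (unit i)) (trans (cong (p *_) (entrySum-unit i)) (*-identityʳ p))

  carry-nonzero : ∀ y i → Nonzero (carry y i)
  carry-nonzero y i = next i , ≤-trans (≤-reflexive (sym (unit-self (next i)))) (m≤n+m _ _)

  covers-carry : ∀ {y} i → p ⋅ unit i ≤ᵛ y → Covers y (carry y i)
  covers-carry {y} i pe≤y τ τ≤carry with τ (next i) in τₙ≡
  ... | zero  = τ , τ≤y , ≡⇒≈ refl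
    where
      τ≤y : τ ≤ᵛ y
      τ≤y j with j ≟ᶠ next i
      ... | yes refl = subst (_≤ y j) (sym τₙ≡) z≤n
      ... | no  j≢n  = begin
        τ j                                   ≤⟨ τ≤carry j ⟩
        y j ∸ p * unit i j + unit (next i) j  ≡⟨ cong (y j ∸ p * unit i j +_) (unit-other j≢n) ⟩
        y j ∸ p * unit i j + 0                ≡⟨ +-identityʳ _ ⟩
        y j ∸ p * unit i j                    ≤⟨ m∸n≤m (y j) (p * unit i j) ⟩
        y j                                   ∎
        where open ≤-Reasoning
  ... | suc _ = z , z≤y , +-cancelʳ (⊖⊕-additive value value-⊕ value-cong (p ⋅ unit i) u≤τ) (value-unit-next≈ i)
    where
      z : Vector ℕ s
      z = τ ⊖ unit (next i) ⊕ p ⋅ unit i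
      u≤τ : unit (next i) ≤ᵛ τ
      u≤τ = unit≤ (subst (0 <_) (sym τₙ≡) z<s)
      z≤y : z ≤ᵛ y
      z≤y j = x≤y∸c+b⇒x∸b+c≤y (τ≤carry j) (pe≤y j)

  record Reduction (y : Vector ℕ s) : Set where
    field
      reduct    : Vector ℕ s
      reduct≤ρ  : reduct ≤ᵛ ρᵛ
      value≈    : value reduct ≈ value y
      nonzero   : Nonzero y → Nonzero reduct
      covered   : Covers y reduct

  opaque
    reduce : ∀ y → Reduction y
    reduce = WF.All.wfRec (On.wellFounded entrySum <-wellFounded) 0ℓ Reduction step
      where
        step : ∀ y → (∀ {y′} → entrySum y′ < entrySum y → Reduction y′) → Reduction y
        step y rec with any (p ≤?_) y
        ... | no  ∄p≤yᵢ = record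
          { reduct   = y
          ; reduct≤ρ = λ i → <⇒≤pred (≰⇒> (λ p≤yᵢ → ∄p≤yᵢ (i , p≤yᵢ)))
          ; value≈   = ≡⇒≈ refl
          ; nonzero  = id
          ; covered  = covers-refl
          }
        ... | yes (i , p≤yᵢ) = record
          { reduct   = reduct
          ; reduct≤ρ = reduct≤ρ
          ; value≈   = ≈-trans value≈ (value-carry i pe≤y)
          ; nonzero  = λ _ → nonzero (carry-nonzero y i)
          ; covered  = covers-trans (covers-carry i pe≤y) covered
          }
          where
            pe≤y : p ⋅ unit i ≤ᵛ y
            pe≤y = ⋅unit≤ p≤yᵢ
            open Reduction (rec {carry y i} (entrySum-carry {y} i pe≤y))

module Rearrangement {p : ℕ} (pr : Prime p) (s′ : ℕ) where

  open Value pr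
  open Period pr s′
  open Carrying pr s′

  Jfrakᵛ : Vector ℕ s → Set
  Jfrakᵛ u = Nonzero u × M p s ∣ value u

  Jfrakᵛ-resp-≗ : ∀ {u w} → u ≗ w → Jfrakᵛ u → Jfrakᵛ w
  Jfrakᵛ-resp-≗ u≗w (u≢𝟘 , M∣u) = Nonzero-resp-≗ u≗w u≢𝟘 , subst (M p s ∣_) (value-cong u≗w) M∣u

  value-ρᵛ≡M : value {s} ρᵛ ≡ M p s
  value-ρᵛ≡M = sym (trans (cong (_∸ 1) (sym (value-ρᵛ s))) (m+n∸n≡m _ 1))

  value≤M : ∀ {u : Vector ℕ s} → u ≤ᵛ ρᵛ → value u ≤ M p s
  value≤M {u} u≤ρ = subst (value u ≤_) value-ρᵛ≡M (value-mono u≤ρ)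

  value≡M⇒ρᵛ : ∀ {u : Vector ℕ s} → u ≤ᵛ ρᵛ → value u ≡ M p s → u ≗ ρᵛ
  value≡M⇒ρᵛ u≤ρ value≡M = value-injective u≤ρ (λ _ → ≤-refl) (trans value≡M (sym value-ρᵛ≡M))

  value≡M-from-Jfrakᵛ : ∀ {u : Vector ℕ s} → u ≤ᵛ ρᵛ → Jfrakᵛ u → value u ≡ M p s
  value≡M-from-Jfrakᵛ u≤ρ (u≢𝟘 , M∣u) = ≤-antisym (value≤M u≤ρ) (∣⇒≤ {{>-nonZero (value-positive u≢𝟘)}} M∣u)

  Jfrakᵛ-digits⇒ρᵛ : ∀ {u : Vector ℕ s} → u ≤ᵛ ρᵛ → Jfrakᵛ u → u ≗ ρᵛ
  Jfrakᵛ-digits⇒ρᵛ u≤ρ Ju = value≡M⇒ρᵛ u≤ρ (value≡M-from-Jfrakᵛ u≤ρ Ju)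

  M∣value<M⇒𝟘 : ∀ {u : Vector ℕ s} → M p s ∣ value u → value u < M p s → u ≗ 𝟘
  M∣value<M⇒𝟘 {u} M∣u u<M with nonzero-or-𝟘 u
  ... | inj₂ u≗𝟘 = u≗𝟘
  ... | inj₁ u≢𝟘 = ⊥-elim (<⇒≱ u<M (∣⇒≤ {{>-nonZero (value-positive u≢𝟘)}} M∣u))

  complement-≤ : ∀ {w γ : Vector ℕ s} → w ≤ᵛ ρᵛ → γ ≤ᵛ ρᵛ →
    value w + value γ ≡ M p s ⊎ value w + value γ ≡ M p s + M p s → ρᵛ ⊖ γ ≤ᵛ w
  complement-≤ {w} {γ} w≤ρ γ≤ρ (inj₁ sum≡M) =
    ≤-reflexive ∘ value-injective (λ i → m∸n≤m (p ∸ 1) (γ i)) w≤ρ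
      (+-cancelʳ-≡ (value γ) _ _ (trans (value-⊖ γ≤ρ) (trans value-ρᵛ≡M (sym sum≡M))))
  complement-≤ {w} {γ} w≤ρ γ≤ρ (inj₂ sum≡2M) i =
    ≤-trans (m∸n≤m (p ∸ 1) (γ i)) (≤-reflexive (sym (value≡M⇒ρᵛ w≤ρ value≡M i)))
    where
      value≡M : value w ≡ M p s
      value≡M = ≤-antisym (value≤M w≤ρ)
        (+-cancelʳ-≤ (M p s) _ _ (≤-trans (≤-reflexive (sym sum≡2M)) (+-monoʳ-≤ (value w) (value≤M γ≤ρ))))

  complement : ∀ {x γ τ : Vector ℕ s} → Jfrakᵛ x → γ ≤ᵛ x → γ ≤ᵛ ρᵛ → τ ≤ᵛ ρᵛ ⊖ γ →
    ∃ λ z → z ≤ᵛ x ⊖ γ × value z ≈ value τ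
  complement {x} {γ} {τ} (x≢𝟘 , M∣x) γ≤x γ≤ρ τ≤ρ⊖γ = covered τ (λ i → ≤-trans (τ≤ρ⊖γ i) (ρ⊖γ≤w i))
    where
      open Reduction (reduce (x ⊖ γ)) renaming (reduct to w)
      M∣sum : M p s ∣ value w + value γ
      M∣sum = ≈-∣ (≈-sym (≈-trans (+-cong value≈ ≈-refl) (≡⇒≈ (value-⊖ γ≤x)))) M∣x
      0<sum : 0 < value w + value γ
      0<sum with nonzero-or-𝟘 γ
      ... | inj₁ γ≢𝟘 = <-≤-trans (value-positive γ≢𝟘) (m≤n+m (value γ) (value w))
      ... | inj₂ γ≗𝟘 = <-≤-trans (value-positive (nonzero (Nonzero-resp-≗ x≗x⊖γ x≢𝟘))) (m≤m+n (value w) (value γ))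
        where
          x≗x⊖γ : x ≗ x ⊖ γ
          x≗x⊖γ i = cong (x i ∸_) (sym (γ≗𝟘 i))
      sum≤2M : value w + value γ ≤ M p s + M p s
      sum≤2M = +-mono-≤ (value≤M reduct≤ρ) (value≤M γ≤ρ)
      ρ⊖γ≤w : ρᵛ ⊖ γ ≤ᵛ w
      ρ⊖γ≤w = complement-≤ reduct≤ρ γ≤ρ (positive-multiple≤n+n M∣sum 0<sum sum≤2M)

  Jfrakᵛ-replace : ∀ {a α z : Vector ℕ s} → Jfrakᵛ a → α ≤ᵛ a → value z ≈ value α → value α < M p s →
    Jfrakᵛ (a ⊖ α ⊕ z)
  Jfrakᵛ-replace {a} {α} {z} Ja α≤a z≈α α<M = δ≢𝟘 (nonzero-or-𝟘 δ) , ≈-∣ (≈-sym value-δ≈) (proj₂ Ja)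
    where
      δ : Vector ℕ s
      δ = a ⊖ α ⊕ z
      value-δ≈ : value δ ≈ value a
      value-δ≈ = begin
        value δ                  ≡⟨ value-⊕ (a ⊖ α) z ⟩
        value (a ⊖ α) + value z  ≈⟨ +-cong (≈-refl {value (a ⊖ α)}) z≈α ⟩
        value (a ⊖ α) + value α  ≡⟨ value-⊖ α≤a ⟩
        value a                  ∎
        where open ≈-Reasoning
      δ≢𝟘 : Nonzero δ ⊎ δ ≗ 𝟘 → Nonzero δ
      δ≢𝟘 (inj₁ δ≢𝟘) = δ≢𝟘
      δ≢𝟘 (inj₂ δ≗𝟘) = Nonzero-mono a≤δ (proj₁ Ja)
        where
          z≗𝟘 : z ≗ 𝟘
          z≗𝟘 i = n≤0⇒n≡0 (≤-trans (m≤n+m (z i) (a i ∸ α i)) (≤-reflexive (δ≗𝟘 i)))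
          M∣α : M p s ∣ value α
          M∣α = ≈-∣ (≈-trans (≡⇒≈ (sym (trans (value-cong z≗𝟘) (value-𝟘 s)))) z≈α) (divides 0 refl)
          a≤δ : a ≤ᵛ δ
          a≤δ i = subst (_≤ δ i) (cong (a i ∸_) (M∣value<M⇒𝟘 {α} M∣α α<M i)) (m≤m+n (a i ∸ α i) (z i))

  Jfrakᵛ-below-split : ∀ {a b v α β : Vector ℕ s} → Jfrakᵛ a → Jfrakᵛ b → v ≤ᵛ ρᵛ →
    α ≤ᵛ a → β ≤ᵛ b → α ⊕ β ≗ v → Nonzero β ⊎ β ≗ 𝟘 → ∃ λ δ → Jfrakᵛ δ × δ ≤ᵛ a ⊕ b ⊖ v
  Jfrakᵛ-below-split {a} {b} {v} {α} Ja Jb v≤ρ α≤a β≤b α+β≗v (inj₂ β≗𝟘) =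
    b , Jb , λ i → subst (b i ≤_) (sym (+-∸-comm (b i) (v≤a i))) (m≤n+m (b i) (a i ∸ v i))
    where
      v≤a : v ≤ᵛ a
      v≤a i = subst (_≤ a i) (trans (sym (+-identityʳ (α i))) (trans (cong (α i +_) (sym (β≗𝟘 i))) (α+β≗v i))) (α≤a i)
  Jfrakᵛ-below-split {a} {b} {v} {α} {β} Ja Jb v≤ρ α≤a β≤b α+β≗v (inj₁ β≢𝟘) =
    a ⊖ α ⊕ z , Jfrakᵛ-replace Ja α≤a z≈α value-α<M , δ≤
    where
      β≤ρ : β ≤ᵛ ρᵛ
      β≤ρ i = ≤-trans (≤-trans (m≤n+m (β i) (α i)) (≤-reflexive (α+β≗v i))) (v≤ρ i)
      α≤ρ⊖β : α ≤ᵛ ρᵛ ⊖ β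
      α≤ρ⊖β i = m+n≤o⇒m≤o∸n (α i) (subst (_≤ p ∸ 1) (sym (α+β≗v i)) (v≤ρ i))
      complement-α : ∃ λ z → z ≤ᵛ b ⊖ β × value z ≈ value α
      complement-α = complement Jb β≤b β≤ρ α≤ρ⊖β
      z : Vector ℕ s
      z = proj₁ complement-α
      z≈α : value z ≈ value α
      z≈α = proj₂ (proj₂ complement-α)
      δ≤ : a ⊖ α ⊕ z ≤ᵛ a ⊕ b ⊖ v
      δ≤ i = ≤-trans (+-monoʳ-≤ (a i ∸ α i) (proj₁ (proj₂ complement-α) i))
        (≤-reflexive (trans ([m∸n]+[o∸q]≡[m+o]∸[n+q] (α≤a i) (β≤b i)) (cong (a i + b i ∸_) (α+β≗v i))))
      value-α<M : value α < M p s
      value-α<M = begin-strict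
        value α            <⟨ m<m+n (value α) (value-positive β≢𝟘) ⟩
        value α + value β  ≡⟨ trans (sym (value-⊕ α β)) (value-cong α+β≗v) ⟩
        value v            ≤⟨ value≤M v≤ρ ⟩
        M p s              ∎
        where open ≤-Reasoning

  Jfrakᵛ-below : ∀ {a b v : Vector ℕ s} → Jfrakᵛ a → Jfrakᵛ b → v ≤ᵛ ρᵛ → v ≤ᵛ a ⊕ b →
    ∃ λ δ → Jfrakᵛ δ × δ ≤ᵛ a ⊕ b ⊖ v
  Jfrakᵛ-below Ja Jb v≤ρ v≤a+b with ⊕-split v≤a+b
  ... | α , β , α≤a , β≤b , α+β≗v = Jfrakᵛ-below-split Ja Jb v≤ρ α≤a β≤b α+β≗v (nonzero-or-𝟘 β)

  exchange : ∀ {a b v : Vector ℕ s} → Jfrakᵛ a → Jfrakᵛ b → v ≤ᵛ ρᵛ → v ≤ᵛ a ⊕ b →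
    ∃₂ λ a′ b′ → Jfrakᵛ a′ × Jfrakᵛ b′ × a′ ⊕ b′ ≗ a ⊕ b × v ≤ᵛ a′
  exchange {a} {b} {v} Ja Jb v≤ρ v≤a+b with nonzero-or-𝟘 v
  ... | inj₂ v≗𝟘 = a , b , Ja , Jb , (λ _ → refl) , λ i → subst (_≤ a i) (sym (v≗𝟘 i)) z≤n
  ... | inj₁ v≢𝟘 with Jfrakᵛ-below Ja Jb v≤ρ v≤a+b
  ...   | δ , Jδ , δ≤a+b⊖v = a ⊕ b ⊖ δ , δ , (Nonzero-mono v≤a′ v≢𝟘 , M∣a′) , Jδ , ⊖-≤-⊕ δ≤a+b , v≤a′
    where
      δ≤a+b : δ ≤ᵛ a ⊕ b
      δ≤a+b i = ≤-trans (δ≤a+b⊖v i) (m∸n≤m _ (v i))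
      v≤a′ : v ≤ᵛ a ⊕ b ⊖ δ
      v≤a′ i = m+n≤o⇒m≤o∸n (v i)
        (subst (_≤ a i + b i) (+-comm (δ i) (v i)) (m≤o∸n⇒m+n≤o (δ i) (v≤a+b i) (δ≤a+b⊖v i)))
      value≡ : value δ + value (a ⊕ b ⊖ δ) ≡ value a + value b
      value≡ = trans (+-comm (value δ) _) (trans (value-⊖ δ≤a+b) (value-⊕ a b))
      M∣a′ : M p s ∣ value (a ⊕ b ⊖ δ)
      M∣a′ = ∣m+n∣m⇒∣n (subst (M p s ∣_) (sym value≡) (∣m∣n⇒∣m+n (proj₂ Ja) (proj₂ Jb))) (proj₂ Jδ)

  record Gathered (m : ℕ) (u v : Vector ℕ s) : Set where
    constructor gathered
    field
      first         : Vector ℕ s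
      others        : List (Vector ℕ s)
      all-J         : All Jfrakᵛ (first ∷ others)
      length-others : length others ≡ m
      sum≗          : ∑ (first ∷ others) ≗ u
      v≤first       : v ≤ᵛ first

  Gathered-resp : ∀ {m n u w v} → m ≡ n → u ≗ w → Gathered m u v → Gathered n w v
  Gathered-resp refl u≗w (gathered d ds J[d∷ds] length≡ ∑≗u v≤d) =
    gathered d ds J[d∷ds] length≡ (λ i → trans (∑≗u i) (u≗w i)) v≤d

  gather : ∀ {d ds v} → All Jfrakᵛ (d ∷ ds) → v ≤ᵛ ρᵛ → v ≤ᵛ ∑ (d ∷ ds) → Gathered (length ds) (∑ (d ∷ ds)) v
  gather {d} {[]} J[d] v≤ρ v≤d+𝟘 = gathered d [] J[d] refl (λ _ → refl) (λ i → subst (_ ≤_) (+-identityʳ (d i)) (v≤d+𝟘 i))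
  gather {d} {e ∷ es} {v} (Jd ∷ J[e∷es]) v≤ρ v≤∑ with ⊕-split v≤∑
  ... | α , β , α≤d , β≤∑ , α+β≗v with gather J[e∷es] β≤ρ β≤∑
    where
      β≤ρ : β ≤ᵛ ρᵛ
      β≤ρ i = ≤-trans (≤-trans (m≤n+m (β i) (α i)) (≤-reflexive (α+β≗v i))) (v≤ρ i)
  ...   | gathered e′ es′ (Je′ ∷ J[es′]) length≡ ∑≗ β≤e′ with exchange Jd Je′ v≤ρ v≤d+e′
    where
      v≤d+e′ : v ≤ᵛ d ⊕ e′
      v≤d+e′ i = subst (_≤ d i + e′ i) (α+β≗v i) (+-mono-≤ (α≤d i) (β≤e′ i))
  ...     | d″ , e″ , Jd″ , Je″ , d″+e″≗d+e′ , v≤d″ =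
    gathered d″ (e″ ∷ es′) (Jd″ ∷ Je″ ∷ J[es′]) (cong suc length≡) ∑≗′ v≤d″
    where
      ∑≗′ : ∑ (d″ ∷ e″ ∷ es′) ≗ ∑ (d ∷ e ∷ es)
      ∑≗′ i = begin
        d″ i + (e″ i + ∑ es′ i)  ≡⟨ sym (+-assoc (d″ i) _ _) ⟩
        d″ i + e″ i + ∑ es′ i    ≡⟨ cong (_+ ∑ es′ i) (d″+e″≗d+e′ i) ⟩
        d i + e′ i + ∑ es′ i     ≡⟨ +-assoc (d i) _ _ ⟩
        d i + (e′ i + ∑ es′ i)   ≡⟨ cong (d i +_) (∑≗ i) ⟩
        d i + ∑ (e ∷ es) i       ∎
        where open ≡-Reasoning

module Decompositions {p : ℕ} (pr : Prime p) (s′ : ℕ) where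

  open Digits pr
  open Value pr
  open Period pr s′
  open Rearrangement pr s′

  -- u = ∑ parts + last: the vector form of an element of V_(m+1) (I⇒Decomposition, Decomposition⇒I).
  record Decomposition (m : ℕ) (u : Vector ℕ s) : Set where
    field
      parts        : List (Vector ℕ s)
      last         : Vector ℕ s
      length-parts : length parts ≡ m
      parts-J      : All Jfrakᵛ parts
      last-nonzero : Nonzero last
      sum≗         : ∑ parts ⊕ last ≗ u

  single : ∀ {w} → Nonzero w → Decomposition 0 w
  single w≢𝟘 = record
    { parts = [] ; last = _ ; length-parts = refl ; parts-J = [] ; last-nonzero = w≢𝟘 ; sum≗ = λ _ → refl }

  infixr 5 _∷ᴰ_
  _∷ᴰ_ : ∀ {m d u} → Jfrakᵛ d → Decomposition m u → Decomposition (suc m) (d ⊕ u)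
  _∷ᴰ_ {d = d} Jd D = record
    { parts        = d ∷ parts
    ; last         = last
    ; length-parts = cong suc length-parts
    ; parts-J      = Jd ∷ parts-J
    ; last-nonzero = last-nonzero
    ; sum≗         = λ i → trans (+-assoc (d i) (∑ parts i) (last i)) (cong (d i +_) (sum≗ i))
    }
    where open Decomposition D

  Decomposition-resp-≗ : ∀ {m u w} → u ≗ w → Decomposition m u → Decomposition m w
  Decomposition-resp-≗ u≗w D = record
    { parts = parts ; last = last ; length-parts = length-parts ; parts-J = parts-J
    ; last-nonzero = last-nonzero ; sum≗ = λ i → trans (sum≗ i) (u≗w i) }
    where open Decomposition D

  Jᵛ : ℕ → Vector ℕ s → Set
  Jᵛ zero    u = ⊥
  Jᵛ (suc m) u = Jfrakᵛ u × Decomposition m u × ¬ Decomposition (suc m) u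

  Jᵛ-resp-≗ : ∀ {m u w} → u ≗ w → Jᵛ m u → Jᵛ m w
  Jᵛ-resp-≗ {suc m} u≗w (Ju , D , ¬D′) =
    Jfrakᵛ-resp-≗ u≗w Ju , Decomposition-resp-≗ u≗w D , ¬D′ ∘ Decomposition-resp-≗ (sym ∘ u≗w)

  M∣value-∑ : ∀ {ds} → All Jfrakᵛ ds → M p s ∣ value (∑ ds)
  M∣value-∑ []              = divides 0 (value-𝟘 s)
  M∣value-∑ {d ∷ ds} (Jd ∷ J[ds]) =
    subst (M p s ∣_) (sym (value-⊕ d (∑ ds))) (∣m∣n⇒∣m+n (proj₂ Jd) (M∣value-∑ J[ds]))

  last-J : ∀ {m u} (D : Decomposition m u) → M p s ∣ value u → Jfrakᵛ (Decomposition.last D)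
  last-J D M∣u = last-nonzero ,
    ∣m+n∣m⇒∣n (subst (M p s ∣_) (trans (sym (value-cong sum≗)) (value-⊕ (∑ parts) last)) M∣u) (M∣value-∑ parts-J)
    where open Decomposition D

  extend : ∀ {m u y} (D : Decomposition m u) → Jfrakᵛ (Decomposition.last D) → Nonzero y → Decomposition (suc m) (u ⊕ y)
  extend {y = y} D J-last y≢𝟘 = record
    { parts        = last ∷ parts
    ; last         = y
    ; length-parts = cong suc length-parts
    ; parts-J      = J-last ∷ parts-J
    ; last-nonzero = y≢𝟘
    ; sum≗         = λ i → cong (_+ y i) (trans (+-comm (last i) (∑ parts i)) (sum≗ i))
    }
    where open Decomposition D

  gather-decomposition : ∀ {m u v} → Decomposition m u → M p s ∣ value u → v ≤ᵛ ρᵛ → v ≤ᵛ u → Gathered m u v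
  gather-decomposition {u = u} {v} D M∣u v≤ρ v≤u =
    Gathered-resp length-parts ∑≗u (gather (last-J D M∣u ∷ parts-J) v≤ρ (λ i → subst (v i ≤_) (sym (∑≗u i)) (v≤u i)))
    where
      open Decomposition D
      ∑≗u : ∑ (last ∷ parts) ≗ u
      ∑≗u i = trans (+-comm (last i) (∑ parts i)) (sum≗ i)

  remove-from-first : ∀ {m u v} → Gathered m u v → v ≤ᵛ ρᵛ → ¬ (v ≗ ρᵛ) → Decomposition m (u ⊖ v)
  remove-from-first {v = v} (gathered d ds (Jd ∷ J[ds]) length≡ ∑≗u v≤d) v≤ρ v≉ρ = record
    { parts        = ds
    ; last         = d ⊖ v
    ; length-parts = length≡
    ; parts-J      = J[ds]
    ; last-nonzero = d⊖v≢𝟘 (nonzero-or-𝟘 (d ⊖ v))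
    ; sum≗         = λ i → trans (+-comm (∑ ds i) (d i ∸ v i))
                       (trans (sym (+-∸-comm (∑ ds i) (v≤d i))) (cong (_∸ v i) (∑≗u i)))
    }
    where
      d⊖v≢𝟘 : Nonzero (d ⊖ v) ⊎ d ⊖ v ≗ 𝟘 → Nonzero (d ⊖ v)
      d⊖v≢𝟘 (inj₁ d⊖v≢𝟘) = d⊖v≢𝟘
      d⊖v≢𝟘 (inj₂ d⊖v≗𝟘) = ⊥-elim (v≉ρ (λ i → trans (sym (d≗v i)) (Jfrakᵛ-digits⇒ρᵛ d≤ρ Jd i)))
        where
          d≗v : d ≗ v
          d≗v i = ≤-antisym (m∸n≡0⇒m≤n (d⊖v≗𝟘 i)) (v≤d i)
          d≤ρ : d ≤ᵛ ρᵛ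
          d≤ρ i = subst (_≤ p ∸ 1) (sym (d≗v i)) (v≤ρ i)

  merge-first-into-next : ∀ {m u v} → Gathered (suc m) u v → Decomposition m (u ⊖ v)
  merge-first-into-next {v = v} (gathered d (e ∷ es) (_ ∷ (e≢𝟘 , _) ∷ J[es]) length≡ ∑≗u v≤d) = record
    { parts        = es
    ; last         = e ⊕ (d ⊖ v)
    ; length-parts = suc-injective length≡
    ; parts-J      = J[es]
    ; last-nonzero = Nonzero-⊕ˡ (d ⊖ v) e≢𝟘
    ; sum≗         = λ i → trans (shuffle (∑ es i) (e i) (d i ∸ v i))
                       (trans (sym (+-∸-comm (e i + ∑ es i) (v≤d i))) (cong (_∸ v i) (∑≗u i)))
    }
    where
      shuffle : ∀ x y z → x + (y + z) ≡ z + (y + x)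
      shuffle = solve-∀

  ρᵛ-nonzero : Nonzero (ρᵛ {s})
  ρᵛ-nonzero = fzero , m<n⇒0<n∸m 1<p

  remove-ρᵛ : ∀ {m u v} → Jᵛ (suc m) u → v ≗ ρᵛ → v ≤ᵛ u → Nonzero (u ⊖ v) →
    Decomposition m (u ⊖ v) ⊎ Jᵛ m (u ⊖ v)
  remove-ρᵛ {zero}  _ _ _ u⊖v≢𝟘 = inj₁ (single u⊖v≢𝟘)
  remove-ρᵛ {suc m} {u} {v} ((_ , M∣u) , D , ¬D′) v≗ρ v≤u u⊖v≢𝟘 =
    inj₂ ((u⊖v≢𝟘 , M∣u⊖v) , merge-first-into-next G , ¬D′ ∘ add-v)
    where
      v≤ρ : v ≤ᵛ ρᵛ
      v≤ρ = ≤-reflexive ∘ v≗ρ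
      G : Gathered (suc m) u v
      G = gather-decomposition D M∣u v≤ρ v≤u
      M∣u⊖v : M p s ∣ value (u ⊖ v)
      M∣u⊖v = ∣m+n∣m⇒∣n (subst (M p s ∣_) (sym (trans (+-comm (value v) (value (u ⊖ v))) (value-⊖ v≤u))) M∣u)
                         (subst (M p s ∣_) (sym (trans (value-cong v≗ρ) value-ρᵛ≡M)) ∣-refl)
      add-v : Decomposition (suc m) (u ⊖ v) → Decomposition (suc (suc m)) u
      add-v D′ = Decomposition-resp-≗ (⊖-≤-⊕ v≤u)
        (extend D′ (last-J D′ M∣u⊖v) (Nonzero-resp-≗ (sym ∘ v≗ρ) ρᵛ-nonzero))

  lemma4p5ᵛ : ∀ {m} {u v : Vector ℕ s} → Jᵛ (suc m) u → v ≤ᵛ ρᵛ → v ≤ᵛ u → Nonzero (u ⊖ v) →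
    Decomposition m (u ⊖ v) ⊎ Jᵛ m (u ⊖ v)
  lemma4p5ᵛ {v = v} Ju@((_ , M∣u) , D , _) v≤ρ v≤u u⊖v≢𝟘 with all? (λ i → v i ≟ p ∸ 1)
  ... | yes v≗ρ = remove-ρᵛ Ju v≗ρ v≤u u⊖v≢𝟘
  ... | no  v≉ρ = inj₁ (remove-from-first (gather-decomposition D M∣u v≤ρ v≤u) v≤ρ v≉ρ)

module Realization {p : ℕ} (pr : Prime p) (s′ : ℕ) where

  open Digits pr
  open Period pr s′
  open Γ-vectors pr s′
  open Rearrangement pr s′
  open Decompositions pr s′

  V-single : ∀ {k} → 0 < k → V pr s 1 k
  V-single {k} 0<k = k ∷ [] , record
    { positive = 0<k VecAll.∷ VecAll.[]
    ; sums     = +-identityʳ k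
    ; noCarry  = λ j → subst (_< p) (sym (+-identityʳ _)) (digit<p j k)
    ; divides  = λ { fzero (s≤s ()) }
    }

  V-prepend : ∀ {n k a t} → 0 < a → a < p ^ t → M p s ∣ a → V pr s n k → V pr s (suc n) (a + p ^ t * k)
  V-prepend {n} {k} {a} {t} 0<a a<p^t M∣a (X , inv) = a ∷ Vec.map (p ^ t *_) X , record
    { positive = 0<a VecAll.∷ map⁺ (VecAll.map (*-mono-< (m^n>0 p t)) positive)
    ; sums     = cong (a +_) (trans (sum-map-* (p ^ t) X) (cong (p ^ t *_) sums))
    ; noCarry  = noCarry′
    ; divides  = divides′
    }
    where
      open InV inv renaming (divides to divisible)
      noCarry′ : NoCarry (a ∷ Vec.map (p ^ t *_) X)
      noCarry′ j with j <? t
      ... | yes j<t = subst (_< p) (sym (trans (cong (digit pr j a +_) (sum-digits-^*-low j t X j<t)) (+-identityʳ _))) (digit<p j a)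
      ... | no  j≮t = subst (_< p)
        (sym (cong₂ _+_ (digit-small j a (<-≤-trans a<p^t (^-monoʳ-≤ p t≤j))) (sum-digits-^*-high j t X t≤j)))
        (noCarry (j ∸ t))
        where
          t≤j = ≮⇒≥ j≮t
      divides′ : ∀ (i : Fin (suc n)) → suc (toℕ i) < suc n → M p s ∣ Vec.lookup (a ∷ Vec.map (p ^ t *_) X) i
      divides′ fzero    _           = M∣a
      divides′ (fsuc i) (s≤s 2+i≤n) = subst (M p s ∣_) (sym (lookup-map i (p ^ t *_) X)) (∣n⇒∣m*n (p ^ t) (divisible i 2+i≤n))

  realize : ∀ parts last → All Jfrakᵛ parts → Nonzero last →
    ∃ λ k → Γᵛ k ≗ ∑ parts ⊕ last × V pr s (suc (length parts)) k
  realize [] last [] last≢𝟘 with Γᵛ-surjective last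
  ... | k , _ , _ , Γk≗last = k , Γk≗last , V-single (Γᵛ-nonzero⁻¹ (Nonzero-resp-≗ (sym ∘ Γk≗last) last≢𝟘))
  realize (d ∷ ds) last (Jd ∷ J[ds]) last≢𝟘 with realize ds last J[ds] last≢𝟘 | Γᵛ-surjective d
  ... | k , Γk≗ , Vk | a , t , a<p^st , Γa≗d = a + p ^ (s * t) * k , Γ≗ , V-prepend {t = s * t} 0<a a<p^st M∣a Vk
    where
      JΓa : Jfrakᵛ (Γᵛ a)
      JΓa = Jfrakᵛ-resp-≗ (sym ∘ Γa≗d) Jd
      0<a : 0 < a
      0<a = Γᵛ-nonzero⁻¹ (proj₁ JΓa)
      M∣a : M p s ∣ a
      M∣a = ≈-∣ (value-Γᵛ a) (proj₂ JΓa)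
      Γ≗ : Γᵛ (a + p ^ (s * t) * k) ≗ ∑ (d ∷ ds) ⊕ last
      Γ≗ i = trans (Γᵛ-+-shift t a k a<p^st i) (trans (cong₂ _+_ (Γa≗d i) (Γk≗ i)) (sym (+-assoc (d i) (∑ ds i) (last i))))

  Decomposition⇒I : ∀ {m u} → Decomposition m (Vec.lookup u) → I pr s (suc m) u
  Decomposition⇒I {u = u} D with realize parts last parts-J last-nonzero
    where open Decomposition D
  ... | k , Γk≗ , Vk =
    k , ≗⇒Γ≡ (λ i → trans (Γk≗ i) (sum≗ i)) , subst (λ n → V pr s (suc n) k) length-parts Vk
    where open Decomposition D

  decompose : ∀ {m} (X : Vec ℕ (suc m)) → VecAll.All (0 <_) X →
    (∀ (i : Fin (suc m)) → suc (toℕ i) < suc m → M p s ∣ Vec.lookup X i) → NoCarry X →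
    Decomposition m (Γᵛ (Vec.sum X))
  decompose (x ∷ []) (0<x VecAll.∷ VecAll.[]) _ _ =
    Decomposition-resp-≗ (λ i → cong (λ e → Γᵛ e i) (sym (+-identityʳ x))) (single (Γᵛ-nonzero 0<x))
  decompose (x ∷ y ∷ Y) (0<x VecAll.∷ positive) divisible noCarry =
    Decomposition-resp-≗ (λ i → sym (Γᵛ-+ x (Vec.sum (y ∷ Y)) noCarry′ i))
      (JΓx ∷ᴰ decompose (y ∷ Y) positive (λ i 2+i<2+m → divisible (fsuc i) (s≤s 2+i<2+m)) noCarry-Y)
    where
      JΓx : Jfrakᵛ (Γᵛ x)
      JΓx = Γᵛ-nonzero 0<x , ≈-∣ (≈-sym (value-Γᵛ x)) (divisible fzero (s≤s (s≤s z≤n)))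
      noCarry-Y : NoCarry (y ∷ Y)
      noCarry-Y = noCarry-tail x (y ∷ Y) noCarry
      noCarry′ : ∀ j → digit pr j x + digit pr j (Vec.sum (y ∷ Y)) < p
      noCarry′ j = subst (λ e → digit pr j x + e < p) (sym (digit-sum (y ∷ Y) noCarry-Y j)) (noCarry j)

  I⇒Decomposition : ∀ {m u} → I pr s (suc m) u → Decomposition m (Vec.lookup u)
  I⇒Decomposition (k , Γk≡u , X , inv) =
    Decomposition-resp-≗ (λ i → trans (cong (λ e → Γᵛ e i) sums) (Γ≡⇒≗ Γk≡u i)) (decompose X positive divisible noCarry)
    where open InV inv renaming (divides to divisible)

  Jfrak⇒Jfrakᵛ : ∀ {u} → Jfrak pr s u → Jfrakᵛ (Vec.lookup u)
  Jfrak⇒Jfrakᵛ (k , 0<k , M∣k , Γk≡u) =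
    Jfrakᵛ-resp-≗ (Γ≡⇒≗ Γk≡u) (Γᵛ-nonzero 0<k , ≈-∣ (≈-sym (value-Γᵛ k)) M∣k)

  Jfrakᵛ⇒Jfrak : ∀ {u} → Jfrakᵛ (Vec.lookup u) → Jfrak pr s u
  Jfrakᵛ⇒Jfrak {u} Ju with Γᵛ-surjective (Vec.lookup u)
  ... | k , _ , _ , Γk≗u = k , Γᵛ-nonzero⁻¹ (proj₁ JΓk) , ≈-∣ (value-Γᵛ k) (proj₂ JΓk) , ≗⇒Γ≡ Γk≗u
    where
      JΓk : Jfrakᵛ (Γᵛ k)
      JΓk = Jfrakᵛ-resp-≗ (sym ∘ Γk≗u) Ju

  J⇒Jᵛ : ∀ {m u} → J pr s m u → Jᵛ m (Vec.lookup u)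
  J⇒Jᵛ {suc m} (Jfrak-u , I-u , ¬I′-u) = Jfrak⇒Jfrakᵛ Jfrak-u , I⇒Decomposition I-u , ¬I′-u ∘ Decomposition⇒I

  Jᵛ⇒J : ∀ {m u} → Jᵛ m (Vec.lookup u) → J pr s m u
  Jᵛ⇒J {suc m} (Ju , D , ¬D′) = Jfrakᵛ⇒Jfrak Ju , Decomposition⇒I D , ¬D′ ∘ I⇒Decomposition

lemma4p5 : (p : ℕ) (pr : Prime p) (s : ℕ) → 1 ≤ s → (m : ℕ) → 1 ≤ m →
    (u v : Vec ℕ s) → J pr s m u → v ≤ᵥ ρ p s → v <ᵥ u →
    I pr s m (u -ᵥ v) ⊎ J pr s (m ∸ 1) (u -ᵥ v)
lemma4p5 p pr (suc s′) _ (suc m) _ u v Ju v≤ρ (v≤u , v≢u) =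
  map-⊎ (Decomposition⇒I ∘ Decomposition-resp-≗ u⊖v≗u-v) (Jᵛ⇒J ∘ Jᵛ-resp-≗ u⊖v≗u-v)
    (lemma4p5ᵛ (J⇒Jᵛ Ju) v≤ρᵛ (lookup-Pointwise v≤u) u⊖v≢𝟘)
  where
    open Value pr
    open Decompositions pr s′
    open Realization pr s′
    u⊖v≗u-v : Vec.lookup u ⊖ Vec.lookup v ≗ Vec.lookup (u -ᵥ v)
    u⊖v≗u-v i = sym (lookup-zipWith _∸_ i u v)
    v≤ρᵛ : Vec.lookup v ≤ᵛ ρᵛ
    v≤ρᵛ i = subst (Vec.lookup v i ≤_) (lookup-replicate i (p ∸ 1)) (lookup-Pointwise v≤ρ i)
    u⊖v≢𝟘 : Nonzero (Vec.lookup u ⊖ Vec.lookup v)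
    u⊖v≢𝟘 with nonzero-or-𝟘 (Vec.lookup u ⊖ Vec.lookup v)
    ... | inj₁ u⊖v≢𝟘 = u⊖v≢𝟘
    ... | inj₂ u⊖v≗𝟘 =
      ⊥-elim (v≢u (lookup-≗⇒≡ λ i → ≤-antisym (lookup-Pointwise v≤u i) (m∸n≡0⇒m≤n (u⊖v≗𝟘 i))))
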